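{- For each integer $d\geq 2$, there are infinitely many pairwise combinatorially inequivalent $d$-dimensional polytopes that are resistance positive.
   Context: Polytopes are convex polytopes, considered up to combinatorial equivalence. For a finite graph $G=(V,E)$ with adjacency matrix $\mathbf{A}$ and diagonal degree matrix $\mathbf{D}$, let $\mathbf{L}=\mathbf{D}-\mathbf{A}$ be its Laplacian and $\mathbf{L}^\dagger$ its Moore--Penrose pseudoinverse. The effective resistance between $u,v\in V$ is $r_{uv}=(\mathbf{1}_u-\mathbf{1}_v)^\top\mathbf{L}^\dagger(\mathbf{1}_u-\mathbf{1}_v)$, where $\mathbf{1}_u$ is the indicator vector of $u$. The resistance curvature at $v$ is $\kappa(v)=1-\frac12\sum_{u\sim v} r_{uv}$, the sum over neighbors $u$ of $v$. A polytope is resistance positive if $\kappa(v)>0$ for every vertex $v$ of its graph (1-skeleton). -}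

module Defs where

open import Data.Nat as ℕ using (ℕ; zero; suc)
open import Data.Fin using (Fin; zero; suc; _≟_)
open import Relation.Nullary.Decidable using (isYes)
open import Data.Bool using (Bool; true; false; if_then_else_)
open import Data.Rational using (ℚ; _+_; _*_; _-_; _≤_; _<_; 0ℚ; 1ℚ; ½)
open import Data.Product using (Σ; ∃; _×_; _,_)
open import Data.Sum using (_⊎_)
open import Relation.Binary.PropositionalEquality using (_≡_; _≢_)
open import Relation.Nullary using (¬_)
open import Function using (_∘_; _⇔_; _↔_; Inverse)

Σℚ : ∀ {n} → (Fin n → ℚ) → ℚ
Σℚ {zero} f = 0ℚ
Σℚ {suc n} f = f zero + Σℚ (f ∘ suc)

Point : ℕ → Set
Point d = Fin d → ℚ

infix 8 _·_
_·_ : ∀ {d} → Point d → Point d → ℚ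
c · x = Σℚ (λ k → c k * x k)

-- Convex polytopes (rational realizations), given by their vertex list.
--   * pts lists pairwise distinct points,
--   * each listed point is a vertex of conv(pts) (strictly exposed by
--     some linear functional), so pts is exactly the vertex set,
--   * the affine hull is all of ℚ^d, i.e. the polytope is d-dimensional:
--     no nonzero linear functional is constant on the vertices.
record Polytope (d : ℕ) : Set where
  field
    n        : ℕ
    pts      : Fin n → Point d
    distinct : ∀ i j → pts i ≡ pts j → i ≡ j
    vertex   : ∀ i → ∃ λ (c : Point d) → ∀ j → j ≢ i → c · pts j < c · pts i
    fullDim  : ∀ (c : Point d) → (∀ i j → c · pts i ≡ c · pts j) → ∀ k → c k ≡ 0ℚ
open Polytope public

IsFace : ∀ {d} (P : Polytope d) → (Fin (n P) → Bool) → Set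
IsFace P S = ∃ λ (c : Point _) → ∃ λ (b : ℚ) →
  ∀ i → (c · pts P i ≤ b) × (S i ≡ true ⇔ c · pts P i ≡ b)

IsEdge : ∀ {d} (P : Polytope d) → Fin (n P) → Fin (n P) → Set
IsEdge P i j = (i ≢ j) × (∃ λ (c : Point _) → ∃ λ (b : ℚ) →
  ∀ k → (c · pts P k ≤ b) × (c · pts P k ≡ b ⇔ (k ≡ i ⊎ k ≡ j)))

-- Combinatorial equivalence: a bijection of vertex sets inducing a
-- bijection of faces (i.e. an isomorphism of face lattices).
CombEquiv : ∀ {d} → Polytope d → Polytope d → Set
CombEquiv P Q = Σ (Fin (n P) ↔ Fin (n Q)) λ σ →
  ∀ (S : Fin (n P) → Bool) → IsFace P S ⇔ IsFace Q (S ∘ Inverse.from σ)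

Mat : ℕ → Set
Mat n = Fin n → Fin n → ℚ

infixl 7 _⊗_
_⊗_ : ∀ {n} → Mat n → Mat n → Mat n
(M ⊗ N) i j = Σℚ (λ k → M i k * N k j)

transpose : ∀ {n} → Mat n → Mat n
transpose M i j = M j i

infix 4 _≐_
_≐_ : ∀ {n} → Mat n → Mat n → Set
M ≐ N = ∀ i j → M i j ≡ N i j

IsMoorePenrose : ∀ {n} → Mat n → Mat n → Set
IsMoorePenrose M X =
  ((M ⊗ X) ⊗ M ≐ M) × ((X ⊗ M) ⊗ X ≐ X) ×
  (transpose (M ⊗ X) ≐ (M ⊗ X)) × (transpose (X ⊗ M) ≐ (X ⊗ M))

toℚ : Bool → ℚ
toℚ b = if b then 1ℚ else 0ℚ

degree : ∀ {n} → (Fin n → Fin n → Bool) → Fin n → ℚ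
degree A v = Σℚ (λ u → toℚ (A v u))

Laplacian : ∀ {n} → (Fin n → Fin n → Bool) → Mat n
Laplacian A i j = (if isYes (i ≟ j) then degree A i else 0ℚ) - toℚ (A i j)

-- Effective resistance r_uv = (1_u - 1_v)ᵀ L† (1_u - 1_v).
resistance : ∀ {n} → Mat n → Fin n → Fin n → ℚ
resistance X u v = ((X u u + X v v) - X u v) - X v u

curvature : ∀ {n} → (Fin n → Fin n → Bool) → Mat n → Fin n → ℚ
curvature A X v = 1ℚ - ½ * Σℚ (λ u → toℚ (A v u) * resistance X u v)

ResistancePositive : ∀ {d} → Polytope d → Set
ResistancePositive P =
  ∃ λ (A : Fin (n P) → Fin (n P) → Bool) →
    (∀ i j → A i j ≡ true ⇔ IsEdge P i j) ×
    ∃ λ (X : Mat (n P)) → IsMoorePenrose (Laplacian A) X ×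
      (∀ v → 0ℚ < curvature A X v)

{-# OPTIONS --safe #-}
-- The polytopes are the prisms C × Δ, where C is the polygon whose N = k + 3 vertices are the
-- points (t, t²), t = 0, …, N − 1, of a parabola and Δ is the e-simplex (d = e + 2). The prism
-- has N (e + 1) vertices, so different k give inequivalent polytopes, and its graph is the
-- Cartesian product C_N □ K_m of a cycle and a complete graph (m = e + 1).
--
-- If X is symmetric with zero column sums and L X = I − c J for the Laplacian L of a graph, then
-- X = L†; if X also has constant diagonal, then Σ_{u ~ v} r_uv = 2 (L X)_vv, so every resistance
-- curvature equals c. For C_N □ K_m such an X is C ⊗ J/m + R ⊗ (I − J/m), where the circulant
-- kernels C and R on the cycle solve L C = I − J/N and (L + m) R = I; this gives c = 1/(N m) > 0.
module Submission where

open import Defs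
open import Data.Nat using (ℕ; _≥_)
open import Data.Product using (Σ; _×_)
open import Relation.Binary.PropositionalEquality using (_≢_)
open import Relation.Nullary using (¬_)

open import Algebra.Bundles using (CommutativeRing)
open import Data.Bool using (Bool; true; false; _∧_; _∨_; not)
open import Data.Bool.Properties using (∨-comm)
open import Data.Empty using (⊥; ⊥-elim)
open import Data.Fin as Fin using (Fin; zero; suc; toℕ; _≟_; _↑ˡ_; _↑ʳ_; combine)
open import Data.Fin.Induction using (<-weakInduction)
open import Data.Fin.Permutation using (↔⇒≡)
import Data.Fin.Properties as Finₚ
open import Data.Nat as ℕ using (zero; suc; z≤n; s≤s; ∣_-_∣)
import Data.Nat.Properties as ℕₚ
open import Data.Product using (∃; _,_; proj₁; proj₂; uncurry)
open import Data.Product.Algebra using (×-distribˡ-⊎; ×-distribʳ-⊎)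
open import Data.Product.Function.NonDependent.Propositional using (_×-⇔_)
open import Data.Product.Properties using (×-≡,≡↔≡)
open import Data.Rational as ℚ using (ℚ; 0ℚ; 1ℚ; ½; _+_; _*_; _-_; -_; _≤_; _<_; 1/_; NonZero)
open import Data.Rational.Properties hiding (_≟_)
import Data.Rational.Properties as ℚₚ
open import Data.Sum using (_⊎_; inj₁; inj₂; [_,_]′; swap)
open import Data.Sum.Function.Propositional using (_⊎-⇔_)
open import Data.Vec.Functional using (_++_; _∷_; [])
open import Data.Vec.Functional.Properties using (lookup-++ˡ; lookup-++ʳ)
open import Function using (_∘_; id; _⇔_; mk⇔; Equivalence)
open import Function.Properties.Equivalence using () renaming (refl to ⇔-refl; trans to ⇔-trans; sym to ⇔-sym)
open import Function.Properties.Inverse using (↔⇒⇔)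
open import Level using (0ℓ)
open import Relation.Binary.Definitions using (tri<; tri≈; tri>)
open import Relation.Binary.PropositionalEquality
open import Relation.Nullary using (Dec; yes; no)
open import Relation.Nullary.Decidable using (isYes; dec⇒maybe; _⊎-dec_)
open import Relation.Unary using (Decidable)
open import Tactic.RingSolver using (solve-∀)
import Tactic.RingSolver.Core.AlmostCommutativeRing as ACR

open import Algebra.Properties.Group +-0-group using () renaming (∙-cancelˡ to +-cancelˡ; ∙-cancelʳ to +-cancelʳ)
open import Algebra.Properties.Ring +-*-ring using ([y-z]x≈yx-zx)
import Algebra.Properties.Semiring.Mult (CommutativeRing.semiring +-*-commutativeRing) as Mult
import Algebra.Properties.Semiring.Sum (CommutativeRing.semiring +-*-commutativeRing) as Sum

ring : ACR.AlmostCommutativeRing 0ℓ 0ℓ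
ring = ACR.fromCommutativeRing +-*-commutativeRing (λ x → dec⇒maybe (0ℚ ℚₚ.≟ x))

-- fromℕ (suc n) reduces to 1ℚ + fromℕ n, which is why the ring lemmas below are stated with
-- such sums where naturals are cast.
fromℕ : ℕ → ℚ
fromℕ n = n Mult.× 1ℚ

fromℕ-+ : ∀ m n → fromℕ (m ℕ.+ n) ≡ fromℕ m + fromℕ n
fromℕ-+ m n = Mult.×-homo-+ 1ℚ m n

fromℕ-∸ : ∀ {m n} → n ℕ.≤ m → fromℕ (m ℕ.∸ n) ≡ fromℕ m - fromℕ n
fromℕ-∸ {m} {n} n≤m = begin
  fromℕ (m ℕ.∸ n)                     ≡⟨ lemma (fromℕ (m ℕ.∸ n)) (fromℕ n) ⟩
  fromℕ (m ℕ.∸ n) + fromℕ n - fromℕ n ≡⟨ cong (λ x → x - fromℕ n) (sym (fromℕ-+ (m ℕ.∸ n) n)) ⟩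
  fromℕ (m ℕ.∸ n ℕ.+ n) - fromℕ n     ≡⟨ cong (λ k → fromℕ k - fromℕ n) (ℕₚ.m∸n+n≡m n≤m) ⟩
  fromℕ m - fromℕ n                   ∎
  where
  open ≡-Reasoning
  lemma : ∀ x y → x ≡ x + y - y
  lemma = solve-∀ ring

0≤-+ : ∀ {p q} → 0ℚ ≤ p → 0ℚ ≤ q → 0ℚ ≤ p + q
0≤-+ {p} {q} 0≤p 0≤q = nonNegative⁻¹ (p + q) {{nonNeg+nonNeg⇒nonNeg p {{ℚ.nonNegative 0≤p}} q {{ℚ.nonNegative 0≤q}}}}

0<-+ : ∀ {p q} → 0ℚ < p → 0ℚ ≤ q → 0ℚ < p + q
0<-+ {p} {q} 0<p 0≤q = positive⁻¹ (p + q) {{pos+nonNeg⇒pos p {{ℚ.positive 0<p}} q {{ℚ.nonNegative 0≤q}}}}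

0≤-* : ∀ {p q} → 0ℚ ≤ p → 0ℚ ≤ q → 0ℚ ≤ p * q
0≤-* {p} {q} 0≤p 0≤q = nonNegative⁻¹ (p * q) {{nonNeg*nonNeg⇒nonNeg p {{ℚ.nonNegative 0≤p}} q {{ℚ.nonNegative 0≤q}}}}

0<-* : ∀ {p q} → 0ℚ < p → 0ℚ < q → 0ℚ < p * q
0<-* {p} {q} 0<p 0<q = positive⁻¹ (p * q) {{pos*pos⇒pos p {{ℚ.positive 0<p}} q {{ℚ.positive 0<q}}}}

0≤fromℕ : ∀ n → 0ℚ ≤ fromℕ n
0≤fromℕ zero    = ≤-refl
0≤fromℕ (suc n) = 0≤-+ (<⇒≤ (positive⁻¹ 1ℚ)) (0≤fromℕ n)

0<fromℕ-suc : ∀ n → 0ℚ < fromℕ (suc n)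
0<fromℕ-suc n = 0<-+ (positive⁻¹ 1ℚ) (0≤fromℕ n)

fromℕ-injective : ∀ {m n} → fromℕ m ≡ fromℕ n → m ≡ n
fromℕ-injective {zero}  {zero}  _ = refl
fromℕ-injective {zero}  {suc n} e = ⊥-elim (<⇒≢ (0<fromℕ-suc n) e)
fromℕ-injective {suc m} {zero}  e = ⊥-elim (<⇒≢ (0<fromℕ-suc m) (sym e))
fromℕ-injective {suc m} {suc n} e = cong suc (fromℕ-injective (+-cancelˡ 1ℚ _ _ e))

fromℕ-≡⇔ : ∀ {m n} → fromℕ m ≡ fromℕ n ⇔ m ≡ n
fromℕ-≡⇔ = mk⇔ fromℕ-injective (cong fromℕ)

fromℕ-mono-≤ : ∀ {m n} → m ℕ.≤ n → fromℕ m ≤ fromℕ n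
fromℕ-mono-≤ {m} m≤n with ℕₚ.m≤n⇒∃[o]m+o≡n m≤n
... | o , refl = subst (_≤ fromℕ (m ℕ.+ o)) (+-identityʳ (fromℕ m))
                       (subst (fromℕ m + 0ℚ ≤_) (sym (fromℕ-+ m o)) (+-monoʳ-≤ (fromℕ m) (0≤fromℕ o)))

fromℕ-suc-nonZero : ∀ k → NonZero (fromℕ (suc k))
fromℕ-suc-nonZero k = pos⇒nonZero (fromℕ (suc k)) {{ℚ.positive (0<fromℕ-suc k)}}

1/[1+_] : ℕ → ℚ
1/[1+ k ] = (1/ fromℕ (suc k)) {{fromℕ-suc-nonZero k}}

*-1/[1+_] : ∀ k → fromℕ (suc k) * 1/[1+ k ] ≡ 1ℚ
*-1/[1+ k ] = *-inverseʳ (fromℕ (suc k)) {{fromℕ-suc-nonZero k}}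

0<1/[1+_] : ∀ k → 0ℚ < 1/[1+ k ]
0<1/[1+ k ] = positive⁻¹ 1/[1+ k ] {{1/pos⇒pos (fromℕ (suc k)) {{ℚ.positive (0<fromℕ-suc k)}}}}

≤∧≢⇒< : ∀ {p q} → p ≤ q → p ≢ q → p < q
≤∧≢⇒< {p} {q} p≤q p≢q with <-cmp p q
... | tri< p<q _ _ = p<q
... | tri≈ _ p≡q _ = ⊥-elim (p≢q p≡q)
... | tri> _ _ q<p = ⊥-elim (<-irrefl refl (<-≤-trans q<p p≤q))

≤⇒0≤- : ∀ {p q} → p ≤ q → 0ℚ ≤ q - p
≤⇒0≤- {p} {q} p≤q = subst (_≤ q - p) (+-inverseʳ p) (+-monoˡ-≤ (- p) p≤q)

≤⇒-≤0 : ∀ {p q} → p ≤ q → p - q ≤ 0ℚ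
≤⇒-≤0 {p} {q} p≤q = subst (p - q ≤_) (+-inverseʳ q) (+-monoˡ-≤ (- q) p≤q)

-≡0⇔≡ : ∀ {p q} → p - q ≡ 0ℚ ⇔ p ≡ q
-≡0⇔≡ {p} {q} = mk⇔ (λ e → trans (lemma p q) (trans (cong (_+ q) e) (+-identityˡ q)))
                    (λ p≡q → trans (cong (_- q) p≡q) (+-inverseʳ q))
  where
  lemma : ∀ p q → p ≡ p - q + q
  lemma = solve-∀ ring

*≡0⇔ : ∀ {p q} → p * q ≡ 0ℚ ⇔ (p ≡ 0ℚ ⊎ q ≡ 0ℚ)
*≡0⇔ {p} {q} = mk⇔ split (λ { (inj₁ refl) → *-zeroˡ q ; (inj₂ refl) → *-zeroʳ p })
  where
  split : p * q ≡ 0ℚ → p ≡ 0ℚ ⊎ q ≡ 0ℚ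
  split pq≡0 with p ℚₚ.≟ 0ℚ
  ... | yes p≡0 = inj₁ p≡0
  ... | no p≢0  = inj₂ (begin
    q                   ≡⟨ sym (*-identityˡ q) ⟩
    1ℚ * q              ≡⟨ cong (_* q) (sym (*-inverseˡ p {{ℚ.≢-nonZero p≢0}})) ⟩
    (1/p * p) * q       ≡⟨ *-assoc 1/p p q ⟩
    1/p * (p * q)       ≡⟨ cong (1/p *_) pq≡0 ⟩
    1/p * 0ℚ            ≡⟨ *-zeroʳ 1/p ⟩
    0ℚ                  ∎)
    where
    open ≡-Reasoning
    1/p = (1/ p) {{ℚ.≢-nonZero p≢0}}

≡-⇔ˡ : ∀ {p q r : ℚ} → p ≡ q → (p ≡ r ⇔ q ≡ r)
≡-⇔ˡ p≡q = mk⇔ (trans (sym p≡q)) (trans p≡q)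

x+y≡z⇔x≡z-y : ∀ {x y z} → (x + y ≡ z ⇔ x ≡ z - y)
x+y≡z⇔x≡z-y {x} {y} {z} = mk⇔ (λ sum≡ → trans (lemma x y) (cong (_- y) sum≡))
                              (λ x≡ → trans (cong (_+ y) x≡) (lemma′ z y))
  where
  lemma : ∀ x y → x ≡ x + y - y
  lemma = solve-∀ ring
  lemma′ : ∀ z y → z - y + y ≡ z
  lemma′ = solve-∀ ring

+-≤⇒≤- : ∀ {x y z} → x + y ≤ z → x ≤ z - y
+-≤⇒≤- {x} {y} {z} x+y≤z = subst (_≤ z - y) (sym (Equivalence.to x+y≡z⇔x≡z-y refl)) (+-monoˡ-≤ (- y) x+y≤z)

+-≡-+⇔ : ∀ {x y a b} → x ≤ a → y ≤ b → (x + y ≡ a + b ⇔ (x ≡ a × y ≡ b))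
+-≡-+⇔ {x} {y} {a} {b} x≤a y≤b = mk⇔ split (λ { (x≡a , y≡b) → cong₂ _+_ x≡a y≡b })
  where
  split : x + y ≡ a + b → x ≡ a × y ≡ b
  split sum≡ with x ℚₚ.≟ a
  ... | yes x≡a = x≡a , +-cancelˡ a y b (trans (cong (_+ y) (sym x≡a)) sum≡)
  ... | no x≢a  = ⊥-elim (<-irrefl sum≡ (+-mono-<-≤ (≤∧≢⇒< x≤a x≢a) y≤b))

δ : ∀ {n} → Fin n → Fin n → ℚ
δ i j = toℚ (isYes (i ≟ j))

δ-refl : ∀ {n} (i : Fin n) → δ i i ≡ 1ℚ
δ-refl i with i ≟ i
... | yes _  = refl
... | no i≢i = ⊥-elim (i≢i refl)

δ-≢ : ∀ {n} {i j : Fin n} → i ≢ j → δ i j ≡ 0ℚ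
δ-≢ {i = i} {j} i≢j with i ≟ j
... | yes i≡j = ⊥-elim (i≢j i≡j)
... | no _    = refl

δ-sym : ∀ {n} (i j : Fin n) → δ i j ≡ δ j i
δ-sym i j with i ≟ j
... | yes refl = sym (δ-refl i)
... | no i≢j   = sym (δ-≢ (i≢j ∘ sym))

δ-suc : ∀ {n} (i j : Fin n) → δ (suc i) (suc j) ≡ δ i j
δ-suc i j with i ≟ j
... | yes _ = refl
... | no _  = refl

Σℚ-cong : ∀ {n} {f g : Fin n → ℚ} → (∀ i → f i ≡ g i) → Σℚ f ≡ Σℚ g
Σℚ-cong {zero}  f≗g = refl
Σℚ-cong {suc n} f≗g = cong₂ _+_ (f≗g zero) (Σℚ-cong (f≗g ∘ suc))

Σℚ≡sum : ∀ {n} (f : Fin n → ℚ) → Σℚ f ≡ Sum.sum f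
Σℚ≡sum {zero}  f = refl
Σℚ≡sum {suc n} f = cong (f zero +_) (Σℚ≡sum (f ∘ suc))

Σℚ-distrib-+ : ∀ {n} (f g : Fin n → ℚ) → Σℚ (λ i → f i + g i) ≡ Σℚ f + Σℚ g
Σℚ-distrib-+ f g = begin
  Σℚ (λ i → f i + g i)       ≡⟨ Σℚ≡sum (λ i → f i + g i) ⟩
  Sum.sum (λ i → f i + g i)  ≡⟨ Sum.∑-distrib-+ f g ⟩
  Sum.sum f + Sum.sum g      ≡⟨ sym (cong₂ _+_ (Σℚ≡sum f) (Σℚ≡sum g)) ⟩
  Σℚ f + Σℚ g                ∎
  where open ≡-Reasoning

*-distribˡ-Σℚ : ∀ {n} x (f : Fin n → ℚ) → x * Σℚ f ≡ Σℚ (λ i → x * f i)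
*-distribˡ-Σℚ x f = begin
  x * Σℚ f                  ≡⟨ cong (x *_) (Σℚ≡sum f) ⟩
  x * Sum.sum f             ≡⟨ Sum.*-distribˡ-sum x f ⟩
  Sum.sum (λ i → x * f i)   ≡⟨ sym (Σℚ≡sum (λ i → x * f i)) ⟩
  Σℚ (λ i → x * f i)        ∎
  where open ≡-Reasoning

Σℚ-linear : ∀ {n} (f g : Fin n → ℚ) α β → Σℚ (λ i → f i * α + g i * β) ≡ Σℚ f * α + Σℚ g * β
Σℚ-linear f g α β = begin
  Σℚ (λ i → f i * α + g i * β)                ≡⟨ Σℚ-distrib-+ (λ i → f i * α) (λ i → g i * β) ⟩
  Σℚ (λ i → f i * α) + Σℚ (λ i → g i * β)     ≡⟨ cong₂ _+_ (scale f α) (scale g β) ⟩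
  Σℚ f * α + Σℚ g * β                          ∎
  where
  open ≡-Reasoning
  scale : ∀ {n} (h : Fin n → ℚ) x → Σℚ (λ i → h i * x) ≡ Σℚ h * x
  scale h x = trans (Σℚ-cong (λ i → *-comm (h i) x))
                    (trans (sym (*-distribˡ-Σℚ x h)) (*-comm x (Σℚ h)))

Σℚ-distrib-- : ∀ {n} (f g : Fin n → ℚ) → Σℚ (λ i → f i - g i) ≡ Σℚ f - Σℚ g
Σℚ-distrib-- f g =
  trans (Σℚ-cong (λ i → lemma (f i) (g i))) (trans (Σℚ-linear f g 1ℚ (- 1ℚ)) (sym (lemma (Σℚ f) (Σℚ g))))
  where
  lemma : ∀ x y → x - y ≡ x * 1ℚ + y * - 1ℚ
  lemma = solve-∀ ring

Σℚ-const : ∀ n x → Σℚ {n} (λ _ → x) ≡ fromℕ n * x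
Σℚ-const zero    x = sym (*-zeroˡ x)
Σℚ-const (suc n) x = trans (cong (x +_) (Σℚ-const n x)) (lemma x (fromℕ n))
  where
  lemma : ∀ x y → x + y * x ≡ (1ℚ + y) * x
  lemma = solve-∀ ring

Σℚ-δ : ∀ {n} (i : Fin n) (f : Fin n → ℚ) → Σℚ (λ j → δ i j * f j) ≡ f i
Σℚ-δ {suc n} zero f = begin
  1ℚ * f zero + Σℚ (λ j → δ zero (suc j) * f (suc j)) ≡⟨ cong (1ℚ * f zero +_) (Σℚ-cong (λ j → *-zeroˡ (f (suc j)))) ⟩
  1ℚ * f zero + Σℚ {n} (λ _ → 0ℚ)                    ≡⟨ cong (1ℚ * f zero +_) (trans (Σℚ-const n 0ℚ) (*-zeroʳ (fromℕ n))) ⟩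
  1ℚ * f zero + 0ℚ                                   ≡⟨ lemma (f zero) ⟩
  f zero                                             ∎
  where
  open ≡-Reasoning
  lemma : ∀ x → 1ℚ * x + 0ℚ ≡ x
  lemma = solve-∀ ring
Σℚ-δ {suc n} (suc i) f = begin
  0ℚ * f zero + Σℚ (λ j → δ (suc i) (suc j) * f (suc j))
    ≡⟨ cong₂ _+_ (*-zeroˡ (f zero)) (Σℚ-cong (λ j → cong (_* f (suc j)) (δ-suc i j))) ⟩
  0ℚ + Σℚ (λ j → δ i j * f (suc j))                      ≡⟨ +-identityˡ _ ⟩
  Σℚ (λ j → δ i j * f (suc j))                           ≡⟨ Σℚ-δ i (f ∘ suc) ⟩
  f (suc i)                                              ∎
  where open ≡-Reasoning

Σℚ-δ-column : ∀ {n} (j : Fin n) → Σℚ (λ i → δ i j) ≡ 1ℚ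
Σℚ-δ-column j = trans (Σℚ-cong (λ i → trans (δ-sym i j) (sym (*-identityʳ (δ j i))))) (Σℚ-δ j (λ _ → 1ℚ))

Σℚ-δ-const : ∀ {n} (i : Fin n) c (f : Fin n → ℚ) → Σℚ (λ j → (δ i j - c) * f j) ≡ f i - c * Σℚ f
Σℚ-δ-const i c f = begin
  Σℚ (λ j → (δ i j - c) * f j)                  ≡⟨ Σℚ-cong (λ j → [y-z]x≈yx-zx (f j) (δ i j) c) ⟩
  Σℚ (λ j → δ i j * f j - c * f j)              ≡⟨ Σℚ-distrib-- (λ j → δ i j * f j) (λ j → c * f j) ⟩
  Σℚ (λ j → δ i j * f j) - Σℚ (λ j → c * f j)   ≡⟨ cong₂ _-_ (Σℚ-δ i f) (sym (*-distribˡ-Σℚ c f)) ⟩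
  f i - c * Σℚ f                                ∎
  where open ≡-Reasoning

Σℚ-↑ : ∀ m {n} (f : Fin (m ℕ.+ n) → ℚ) → Σℚ f ≡ Σℚ (λ i → f (i ↑ˡ n)) + Σℚ (λ j → f (m ↑ʳ j))
Σℚ-↑ zero    f = sym (+-identityˡ (Σℚ f))
Σℚ-↑ (suc m) f = trans (cong (f zero +_) (Σℚ-↑ m (f ∘ suc))) (sym (+-assoc (f zero) _ _))

Σℚ-combine : ∀ n {m} (f : Fin (n ℕ.* m) → ℚ) → Σℚ f ≡ Σℚ (λ t → Σℚ (λ a → f (combine {n} {m} t a)))
Σℚ-combine zero    f = refl
Σℚ-combine (suc n) {m} f =
  trans (Σℚ-↑ m f) (cong (Σℚ (λ a → f (a ↑ˡ (n ℕ.* m))) +_) (Σℚ-combine n {m} (λ v → f (m ↑ʳ v))))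

-- Laplacians and their pseudoinverses

module _ {n} (A : Fin n → Fin n → Bool) where

  laplacian-δ : ∀ u v → Laplacian A u v ≡ δ u v * degree A u - toℚ (A u v)
  laplacian-δ u v with u ≟ v
  ... | yes _ = cong (_- toℚ (A u v)) (sym (*-identityˡ (degree A u)))
  ... | no _  = cong (_- toℚ (A u v)) (sym (*-zeroˡ (degree A u)))

  laplacian-apply : ∀ u (f : Fin n → ℚ) →
    Σℚ (λ v → Laplacian A u v * f v) ≡ degree A u * f u - Σℚ (λ v → toℚ (A u v) * f v)
  laplacian-apply u f = begin
    Σℚ (λ v → Laplacian A u v * f v)
      ≡⟨ Σℚ-cong (λ v → trans (cong (_* f v) (laplacian-δ u v)) (lemma (δ u v) (degree A u) (toℚ (A u v)) (f v))) ⟩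
    Σℚ (λ v → δ u v * (degree A u * f v) - toℚ (A u v) * f v)
      ≡⟨ Σℚ-distrib-- (λ v → δ u v * (degree A u * f v)) (λ v → toℚ (A u v) * f v) ⟩
    Σℚ (λ v → δ u v * (degree A u * f v)) - Σℚ (λ v → toℚ (A u v) * f v)
      ≡⟨ cong (_- Σℚ (λ v → toℚ (A u v) * f v)) (Σℚ-δ u (λ v → degree A u * f v)) ⟩
    degree A u * f u - Σℚ (λ v → toℚ (A u v) * f v) ∎
    where
    open ≡-Reasoning
    lemma : ∀ d D a x → (d * D - a) * x ≡ d * (D * x) - a * x
    lemma = solve-∀ ring

  laplacian-≢ : ∀ {u v} → u ≢ v → Laplacian A u v ≡ - toℚ (A u v)
  laplacian-≢ {u} {v} u≢v with u ≟ v
  ... | yes u≡v = ⊥-elim (u≢v u≡v)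
  ... | no _    = +-identityˡ (- toℚ (A u v))

  module _ (A-sym : ∀ u v → A u v ≡ A v u) where

    laplacian-sym : ∀ u v → Laplacian A u v ≡ Laplacian A v u
    laplacian-sym u v = by-cases (u ≟ v)
      where
      open ≡-Reasoning
      by-cases : Dec (u ≡ v) → Laplacian A u v ≡ Laplacian A v u
      by-cases (yes refl) = refl
      by-cases (no u≢v)   = begin
        Laplacian A u v  ≡⟨ laplacian-≢ u≢v ⟩
        - toℚ (A u v)    ≡⟨ cong (λ a → - toℚ a) (A-sym u v) ⟩
        - toℚ (A v u)    ≡⟨ sym (laplacian-≢ (u≢v ∘ sym)) ⟩
        Laplacian A v u  ∎

    Σℚ-laplacian-column : ∀ v → Σℚ (λ u → Laplacian A u v) ≡ 0ℚ
    Σℚ-laplacian-column v = begin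
      Σℚ (λ u → Laplacian A u v)                         ≡⟨ Σℚ-cong (λ u → trans (laplacian-sym u v) (sym (*-identityʳ _))) ⟩
      Σℚ (λ u → Laplacian A v u * 1ℚ)                    ≡⟨ laplacian-apply v (λ _ → 1ℚ) ⟩
      degree A v * 1ℚ - Σℚ (λ u → toℚ (A v u) * 1ℚ)
        ≡⟨ cong₂ _-_ (*-identityʳ (degree A v)) (Σℚ-cong (λ u → *-identityʳ (toℚ (A v u)))) ⟩
      degree A v - degree A v                            ≡⟨ +-inverseʳ (degree A v) ⟩
      0ℚ                                                 ∎
      where open ≡-Reasoning

    module _ (X : Mat n) (c : ℚ) (X-sym : ∀ u v → X u v ≡ X v u)
             (LX≡I-c : ∀ u v → (Laplacian A ⊗ X) u v ≡ δ u v - c) where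

      XL≡I-c : ∀ u v → (X ⊗ Laplacian A) u v ≡ δ u v - c
      XL≡I-c u v = begin
        Σℚ (λ w → X u w * Laplacian A w v)  ≡⟨ Σℚ-cong (λ w → trans (*-comm (X u w) _) (cong₂ _*_ (laplacian-sym w v) (X-sym u w))) ⟩
        Σℚ (λ w → Laplacian A v w * X w u)  ≡⟨ LX≡I-c v u ⟩
        δ v u - c                           ≡⟨ cong (_- c) (δ-sym v u) ⟩
        δ u v - c                           ∎
        where open ≡-Reasoning

      isMoorePenrose : (∀ v → Σℚ (λ u → X u v) ≡ 0ℚ) → IsMoorePenrose (Laplacian A) X
      isMoorePenrose Σ-column =
        (λ u v → absorb {u} (λ w → Laplacian A w v) (LX≡I-c u) (Σℚ-laplacian-column v)) ,
        (λ u v → absorb {u} (λ w → X w v) (XL≡I-c u) (Σ-column v)) ,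
        (λ u v → trans (LX≡I-c v u) (trans (cong (_- c) (δ-sym v u)) (sym (LX≡I-c u v)))) ,
        (λ u v → trans (XL≡I-c v u) (trans (cong (_- c) (δ-sym v u)) (sym (XL≡I-c u v))))
        where
        absorb : ∀ {u} {row : Fin n → ℚ} (f : Fin n → ℚ) → (∀ w → row w ≡ δ u w - c) →
                 Σℚ f ≡ 0ℚ → Σℚ (λ w → row w * f w) ≡ f u
        absorb {u} {row} f row≡δ-c Σf≡0 = begin
          Σℚ (λ w → row w * f w)        ≡⟨ Σℚ-cong (λ w → cong (_* f w) (row≡δ-c w)) ⟩
          Σℚ (λ w → (δ u w - c) * f w)  ≡⟨ Σℚ-δ-const u c f ⟩
          f u - c * Σℚ f                ≡⟨ cong (λ s → f u - c * s) Σf≡0 ⟩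
          f u - c * 0ℚ                  ≡⟨ lemma (f u) c ⟩
          f u                           ∎
          where
          open ≡-Reasoning
          lemma : ∀ x c → x - c * 0ℚ ≡ x
          lemma = solve-∀ ring

      curvature-≡ : ∀ {x₀} → (∀ u → X u u ≡ x₀) → ∀ v → curvature A X v ≡ c
      curvature-≡ {x₀} X-diag v = begin
        1ℚ - ½ * Σℚ (λ u → a u * resistance X u v)
          ≡⟨ cong (λ s → 1ℚ - ½ * s) (Σℚ-cong resistance-term) ⟩
        1ℚ - ½ * Σℚ (λ u → a u * (x₀ + x₀) + (a u * X u v) * - (1ℚ + 1ℚ))
          ≡⟨ cong (λ s → 1ℚ - ½ * s) (Σℚ-linear a (λ u → a u * X u v) (x₀ + x₀) (- (1ℚ + 1ℚ))) ⟩
        1ℚ - ½ * (degree A v * (x₀ + x₀) + Σℚ (λ u → a u * X u v) * - (1ℚ + 1ℚ))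
          ≡⟨ cong (λ s → 1ℚ - ½ * (degree A v * (x₀ + x₀) + s * - (1ℚ + 1ℚ))) Σ-neighbours ⟩
        1ℚ - ½ * (degree A v * (x₀ + x₀) + (degree A v * x₀ - (1ℚ - c)) * - (1ℚ + 1ℚ))
          ≡⟨ lemma (degree A v) x₀ c ⟩
        c ∎
        where
        open ≡-Reasoning
        a : Fin n → ℚ
        a u = toℚ (A v u)
        resistance-term : ∀ u → a u * resistance X u v ≡ a u * (x₀ + x₀) + (a u * X u v) * - (1ℚ + 1ℚ)
        resistance-term u = trans (cong (a u *_) (cong₂ (λ x y → ((x + y) - X u v) - X v u) (X-diag u) (X-diag v)))
                                  (trans (cong (λ z → a u * (((x₀ + x₀) - X u v) - z)) (X-sym v u)) (expand (a u) x₀ (X u v)))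
          where
          expand : ∀ a x y → a * ((x + x - y) - y) ≡ a * (x + x) + (a * y) * - (1ℚ + 1ℚ)
          expand = solve-∀ ring
        Σ-neighbours : Σℚ (λ u → a u * X u v) ≡ degree A v * x₀ - (1ℚ - c)
        Σ-neighbours = begin
          Σℚ (λ u → a u * X u v)                                    ≡⟨ rearrange (degree A v * X v v) _ ⟩
          degree A v * X v v - (degree A v * X v v - Σℚ (λ u → a u * X u v))
            ≡⟨ cong₂ (λ x y → degree A v * x - y) (X-diag v) (sym (laplacian-apply v (λ u → X u v))) ⟩
          degree A v * x₀ - (Laplacian A ⊗ X) v v
            ≡⟨ cong (λ y → degree A v * x₀ - y) (trans (LX≡I-c v v) (cong (_- c) (δ-refl v))) ⟩
          degree A v * x₀ - (1ℚ - c)                                ∎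
          where
          rearrange : ∀ x s → s ≡ x - (x - s)
          rearrange = solve-∀ ring
        lemma : ∀ D x c → 1ℚ - ½ * (D * (x + x) + (D * x - (1ℚ - c)) * - (1ℚ + 1ℚ)) ≡ c
        lemma = solve-∀ ring

-- Cartesian products with complete graphs

≟-sym : ∀ {n} (i j : Fin n) → isYes (i ≟ j) ≡ isYes (j ≟ i)
≟-sym i j with i ≟ j | j ≟ i
... | yes _   | yes _   = refl
... | no _    | no _    = refl
... | yes i≡j | no j≢i  = ⊥-elim (j≢i (sym i≡j))
... | no i≢j  | yes j≡i = ⊥-elim (i≢j (sym j≡i))

module Pairs (N m : ℕ) where

  base : Fin (N ℕ.* m) → Fin N
  base = Fin.quotient m

  fibre : Fin (N ℕ.* m) → Fin m
  fibre = Fin.remainder {N} m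

  Σℚ-pairs : (g : Fin N → Fin m → ℚ) → Σℚ (λ v → g (base v) (fibre v)) ≡ Σℚ (λ t → Σℚ (λ a → g t a))
  Σℚ-pairs g = trans (Σℚ-combine N (λ v → g (base v) (fibre v)))
                     (Σℚ-cong (λ t → Σℚ-cong (λ a → cong (uncurry g) (Finₚ.remQuot-combine t a))))

  ≡-pairs : ∀ {u w} → base u ≡ base w → fibre u ≡ fibre w → u ≡ w
  ≡-pairs {u} {w} t≡s a≡b = begin
    u                                 ≡⟨ sym (Finₚ.combine-remQuot {N} m u) ⟩
    combine (base u) (fibre u)        ≡⟨ cong₂ combine t≡s a≡b ⟩
    combine (base w) (fibre w)        ≡⟨ Finₚ.combine-remQuot {N} m w ⟩
    w                                 ∎
    where open ≡-Reasoning

  δ-pairs : ∀ u w → δ u w ≡ δ (base u) (base w) * δ (fibre u) (fibre w)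
  δ-pairs u w with u ≟ w
  ... | yes refl = sym (trans (cong₂ _*_ (δ-refl (base u)) (δ-refl (fibre u))) (*-identityˡ 1ℚ))
  ... | no u≢w with base u ≟ base w | fibre u ≟ fibre w
  ...   | yes t≡s | yes a≡b = ⊥-elim (u≢w (≡-pairs t≡s a≡b))
  ...   | no _    | a≟b     = sym (*-zeroˡ (toℚ (isYes a≟b)))
  ...   | yes _   | no _    = sym (*-zeroʳ 1ℚ)

_□K[_] : ∀ {N} → (Fin N → Fin N → Bool) → (m : ℕ) → Fin (N ℕ.* m) → Fin (N ℕ.* m) → Bool
_□K[_] {N} A m u w =
  (A (base u) (base w) ∧ isYes (fibre u ≟ fibre w)) ∨ (isYes (base u ≟ base w) ∧ not (isYes (fibre u ≟ fibre w)))
  where open Pairs N m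

toℚ-∧∨ : ∀ x y z → toℚ ((x ∧ y) ∨ (z ∧ not y)) ≡ toℚ x * toℚ y + toℚ z * (1ℚ - toℚ y)
toℚ-∧∨ true  true  true  = refl
toℚ-∧∨ true  true  false = refl
toℚ-∧∨ true  false true  = refl
toℚ-∧∨ true  false false = refl
toℚ-∧∨ false true  true  = refl
toℚ-∧∨ false true  false = refl
toℚ-∧∨ false false true  = refl
toℚ-∧∨ false false false = refl

module □K-Graph {N : ℕ} (A : Fin N → Fin N → Bool) (m : ℕ) where
  open Pairs N m

  Σℚ-□K-neighbours : ∀ u (F : Fin N → Fin m → ℚ) →
    Σℚ (λ v → toℚ ((A □K[ m ]) u v) * F (base v) (fibre v))
      ≡ Σℚ (λ s → toℚ (A (base u) s) * F s (fibre u)) + (Σℚ (λ b → F (base u) b) - F (base u) (fibre u))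
  Σℚ-□K-neighbours u F = begin
    Σℚ (λ v → toℚ ((A □K[ m ]) u v) * F (base v) (fibre v))
      ≡⟨ Σℚ-pairs (λ s b → toℚ (edge s b) * F s b) ⟩
    Σℚ (λ s → Σℚ (λ b → toℚ (edge s b) * F s b))
      ≡⟨ Σℚ-cong along-fibre ⟩
    Σℚ (λ s → toℚ (A t s) * F s a + δ t s * W s)
      ≡⟨ Σℚ-distrib-+ (λ s → toℚ (A t s) * F s a) (λ s → δ t s * W s) ⟩
    Σℚ (λ s → toℚ (A t s) * F s a) + Σℚ (λ s → δ t s * W s)
      ≡⟨ cong (Σℚ (λ s → toℚ (A t s) * F s a) +_) (Σℚ-δ t W) ⟩
    Σℚ (λ s → toℚ (A t s) * F s a) + W t ∎
    where
    open ≡-Reasoning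
    t = base u
    a = fibre u
    edge : Fin N → Fin m → Bool
    edge s b = (A t s ∧ isYes (a ≟ b)) ∨ (isYes (t ≟ s) ∧ not (isYes (a ≟ b)))
    W : Fin N → ℚ
    W s = Σℚ (λ b → F s b) - F s a
    along-fibre : ∀ s → Σℚ (λ b → toℚ (edge s b) * F s b) ≡ toℚ (A t s) * F s a + δ t s * W s
    along-fibre s = begin
      Σℚ (λ b → toℚ (edge s b) * F s b)
        ≡⟨ Σℚ-cong (λ b → trans (cong (_* F s b) (toℚ-∧∨ (A t s) (isYes (a ≟ b)) (isYes (t ≟ s))))
                                (lemma (toℚ (A t s)) (δ a b) (δ t s) (F s b))) ⟩
      Σℚ (λ b → δ a b * (toℚ (A t s) * F s b) + δ t s * (F s b - δ a b * F s b))
        ≡⟨ Σℚ-distrib-+ (λ b → δ a b * (toℚ (A t s) * F s b)) (λ b → δ t s * (F s b - δ a b * F s b)) ⟩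
      Σℚ (λ b → δ a b * (toℚ (A t s) * F s b)) + Σℚ (λ b → δ t s * (F s b - δ a b * F s b))
        ≡⟨ cong₂ _+_ (Σℚ-δ a (λ b → toℚ (A t s) * F s b)) (sym (*-distribˡ-Σℚ (δ t s) (λ b → F s b - δ a b * F s b))) ⟩
      toℚ (A t s) * F s a + δ t s * Σℚ (λ b → F s b - δ a b * F s b)
        ≡⟨ cong (λ x → toℚ (A t s) * F s a + δ t s * x)
                (trans (Σℚ-distrib-- (F s) (λ b → δ a b * F s b)) (cong (λ x → Σℚ (F s) - x) (Σℚ-δ a (F s)))) ⟩
      toℚ (A t s) * F s a + δ t s * W s ∎
      where
      lemma : ∀ x y z f → (x * y + z * (1ℚ - y)) * f ≡ y * (x * f) + z * (f - y * f)
      lemma = solve-∀ ring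

  □K≡true⇔ : ∀ u w → (A □K[ m ]) u w ≡ true ⇔
    ((A (base u) (base w) ≡ true × fibre u ≡ fibre w) ⊎ (base u ≡ base w × fibre u ≢ fibre w))
  □K≡true⇔ u w with fibre u ≟ fibre w | base u ≟ base w | A (base u) (base w)
  ... | yes a≡b | _       | true  = mk⇔ (λ _ → inj₁ (refl , a≡b)) (λ _ → refl)
  ... | yes a≡b | yes _   | false = mk⇔ (λ ()) [ (λ ()) ∘ proj₁ , (λ a≢b → ⊥-elim (a≢b a≡b)) ∘ proj₂ ]′
  ... | yes a≡b | no _    | false = mk⇔ (λ ()) [ (λ ()) ∘ proj₁ , (λ a≢b → ⊥-elim (a≢b a≡b)) ∘ proj₂ ]′
  ... | no a≢b  | yes t≡s | true  = mk⇔ (λ _ → inj₂ (t≡s , a≢b)) (λ _ → refl)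
  ... | no a≢b  | yes t≡s | false = mk⇔ (λ _ → inj₂ (t≡s , a≢b)) (λ _ → refl)
  ... | no a≢b  | no t≢s  | true  = mk⇔ (λ ()) [ ⊥-elim ∘ a≢b ∘ proj₂ , ⊥-elim ∘ t≢s ∘ proj₁ ]′
  ... | no a≢b  | no t≢s  | false = mk⇔ (λ ()) [ ⊥-elim ∘ a≢b ∘ proj₂ , ⊥-elim ∘ t≢s ∘ proj₁ ]′

  degree-□K : ∀ u → degree (A □K[ m ]) u ≡ degree A (base u) + (fromℕ m - 1ℚ)
  degree-□K u = begin
    Σℚ (λ v → toℚ ((A □K[ m ]) u v))
      ≡⟨ Σℚ-cong (λ v → sym (*-identityʳ (toℚ ((A □K[ m ]) u v)))) ⟩
    Σℚ (λ v → toℚ ((A □K[ m ]) u v) * 1ℚ)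
      ≡⟨ Σℚ-□K-neighbours u (λ _ _ → 1ℚ) ⟩
    Σℚ (λ s → toℚ (A (base u) s) * 1ℚ) + (Σℚ {m} (λ _ → 1ℚ) - 1ℚ)
      ≡⟨ cong₂ (λ x y → x + (y - 1ℚ)) (Σℚ-cong (λ s → *-identityʳ (toℚ (A (base u) s))))
                                      (trans (Σℚ-const m 1ℚ) (*-identityʳ (fromℕ m))) ⟩
    degree A (base u) + (fromℕ m - 1ℚ) ∎
    where open ≡-Reasoning

  □K-sym : (∀ t s → A t s ≡ A s t) → ∀ u w → (A □K[ m ]) u w ≡ (A □K[ m ]) w u
  □K-sym A-sym u w =
    cong₃ (λ x y z → (x ∧ y) ∨ (z ∧ not y)) (A-sym (base u) (base w)) (≟-sym (fibre u) (fibre w)) (≟-sym (base u) (base w))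
    where
    cong₃ : ∀ (f : Bool → Bool → Bool → Bool) {x x′ y y′ z z′} → x ≡ x′ → y ≡ y′ → z ≡ z′ → f x y z ≡ f x′ y′ z′
    cong₃ f refl refl refl = refl

module □K-Kernel {N : ℕ} (A : Fin N → Fin N → Bool) (m : ℕ) (m⁻¹ : ℚ) (m*m⁻¹≡1 : fromℕ m * m⁻¹ ≡ 1ℚ)
                   (C R : Mat N) where
  open Pairs N m
  open □K-Graph A m

  kernel : Fin N → Fin m → Fin N → Fin m → ℚ
  kernel t a s b = C t s * m⁻¹ + R t s * (δ a b - m⁻¹)

  X : Mat (N ℕ.* m)
  X u w = kernel (base u) (fibre u) (base w) (fibre w)

  Σℚ-centred : ∀ (b : Fin m) → Σℚ (λ a → δ a b - m⁻¹) ≡ 0ℚ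
  Σℚ-centred b = begin
    Σℚ (λ a → δ a b - m⁻¹)              ≡⟨ Σℚ-distrib-- (λ a → δ a b) (λ _ → m⁻¹) ⟩
    Σℚ (λ a → δ a b) - Σℚ {m} (λ _ → m⁻¹) ≡⟨ cong₂ _-_ (Σℚ-δ-column b) (trans (Σℚ-const m m⁻¹) m*m⁻¹≡1) ⟩
    1ℚ - 1ℚ                             ≡⟨ +-inverseʳ 1ℚ ⟩
    0ℚ                                  ∎
    where open ≡-Reasoning

  Σℚ-kernel-fibre : ∀ t s (b : Fin m) → Σℚ (λ a → kernel t a s b) ≡ C t s
  Σℚ-kernel-fibre t s b = begin
    Σℚ (λ a → C t s * m⁻¹ + R t s * (δ a b - m⁻¹))
      ≡⟨ Σℚ-cong (λ a → cong (C t s * m⁻¹ +_) (*-comm (R t s) (δ a b - m⁻¹))) ⟩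
    Σℚ (λ a → C t s * m⁻¹ + (δ a b - m⁻¹) * R t s)
      ≡⟨ Σℚ-linear (λ _ → C t s) (λ a → δ a b - m⁻¹) m⁻¹ (R t s) ⟩
    Σℚ {m} (λ _ → C t s) * m⁻¹ + Σℚ (λ a → δ a b - m⁻¹) * R t s
      ≡⟨ cong₂ (λ x y → x * m⁻¹ + y * R t s) (Σℚ-const m (C t s)) (Σℚ-centred b) ⟩
    fromℕ m * C t s * m⁻¹ + 0ℚ * R t s
      ≡⟨ lemma (fromℕ m) m⁻¹ (C t s) (R t s) ⟩
    (fromℕ m * m⁻¹) * C t s
      ≡⟨ trans (cong (_* C t s) m*m⁻¹≡1) (*-identityˡ (C t s)) ⟩
    C t s ∎
    where
    open ≡-Reasoning
    lemma : ∀ k k⁻¹ c r → k * c * k⁻¹ + 0ℚ * r ≡ (k * k⁻¹) * c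
    lemma = solve-∀ ring

  laplacian-X : ∀ c → (∀ t s → (Laplacian A ⊗ C) t s ≡ δ t s - c) →
                (∀ t s → (Laplacian A ⊗ R) t s + fromℕ m * R t s ≡ δ t s) →
                ∀ u w → (Laplacian (A □K[ m ]) ⊗ X) u w ≡ δ u w - c * m⁻¹
  laplacian-X c LC≡I-c [L+m]R≡I u w = begin
    (Laplacian (A □K[ m ]) ⊗ X) u w
      ≡⟨ laplacian-apply (A □K[ m ]) u (λ v → X v w) ⟩
    degree (A □K[ m ]) u * X u w - Σℚ (λ v → toℚ ((A □K[ m ]) u v) * X v w)
      ≡⟨ cong₂ (λ D S → D * X u w - S) (degree-□K u) (Σℚ-□K-neighbours u (λ r e → kernel r e s b)) ⟩
    (D + (fromℕ m - 1ℚ)) * X u w - (Σℚ (λ r → a r * kernel r (fibre u) s b) + (Σℚ (λ e → kernel t e s b) - X u w))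
      ≡⟨ cong₂ (λ x y → (D + (fromℕ m - 1ℚ)) * X u w - (x + (y - X u w))) Σ-neighbours (Σℚ-kernel-fibre t s b) ⟩
    (D + (fromℕ m - 1ℚ)) * (C t s * m⁻¹ + R t s * β) - ((SC * m⁻¹ + SR * β) + (C t s - (C t s * m⁻¹ + R t s * β)))
      ≡⟨ regroup D (fromℕ m) m⁻¹ (C t s) (R t s) SC SR β ⟩
    (D * C t s - SC) * m⁻¹ + ((D * R t s - SR) + fromℕ m * R t s) * β + (fromℕ m * m⁻¹ - 1ℚ) * C t s
      ≡⟨ cong₃ (trans (sym (laplacian-apply A t (λ r → C r s))) (LC≡I-c t s))
               (trans (cong (_+ fromℕ m * R t s) (sym (laplacian-apply A t (λ r → R r s)))) ([L+m]R≡I t s))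
               m*m⁻¹≡1 ⟩
    (δ t s - c) * m⁻¹ + δ t s * β + (1ℚ - 1ℚ) * C t s
      ≡⟨ simplify (δ t s) c m⁻¹ (δ (fibre u) b) (C t s) ⟩
    δ t s * δ (fibre u) b - c * m⁻¹
      ≡⟨ cong (_- c * m⁻¹) (sym (δ-pairs u w)) ⟩
    δ u w - c * m⁻¹ ∎
    where
    open ≡-Reasoning
    t = base u
    s = base w
    b = fibre w
    β = δ (fibre u) b - m⁻¹
    D = degree A t
    a : Fin N → ℚ
    a r = toℚ (A t r)
    SC = Σℚ (λ r → a r * C r s)
    SR = Σℚ (λ r → a r * R r s)
    Σ-neighbours : Σℚ (λ r → a r * kernel r (fibre u) s b) ≡ SC * m⁻¹ + SR * β
    Σ-neighbours = trans (Σℚ-cong (λ r → distribute (a r) (C r s) (R r s) m⁻¹ β))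
                         (Σℚ-linear (λ r → a r * C r s) (λ r → a r * R r s) m⁻¹ β)
      where
      distribute : ∀ a c r i β → a * (c * i + r * β) ≡ a * c * i + a * r * β
      distribute = solve-∀ ring
    regroup : ∀ D k k⁻¹ c r sc sr β →
      (D + (k - 1ℚ)) * (c * k⁻¹ + r * β) - ((sc * k⁻¹ + sr * β) + (c - (c * k⁻¹ + r * β)))
        ≡ (D * c - sc) * k⁻¹ + ((D * r - sr) + k * r) * β + (k * k⁻¹ - 1ℚ) * c
    regroup = solve-∀ ring
    cong₃ : ∀ {x x′ y y′ z z′} → x ≡ x′ → y ≡ y′ → z ≡ z′ →
            x * m⁻¹ + y * β + (z - 1ℚ) * C t s ≡ x′ * m⁻¹ + y′ * β + (z′ - 1ℚ) * C t s
    cong₃ refl refl refl = refl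
    simplify : ∀ d c i e x → (d - c) * i + d * (e - i) + (1ℚ - 1ℚ) * x ≡ d * e - c * i
    simplify = solve-∀ ring

  X-sym : (∀ t s → C t s ≡ C s t) → (∀ t s → R t s ≡ R s t) → ∀ u w → X u w ≡ X w u
  X-sym C-sym R-sym u w =
    cong₃ (C-sym (base u) (base w)) (R-sym (base u) (base w)) (δ-sym (fibre u) (fibre w))
    where
    cong₃ : ∀ {x x′ y y′ z z′} → x ≡ x′ → y ≡ y′ → z ≡ z′ → x * m⁻¹ + y * (z - m⁻¹) ≡ x′ * m⁻¹ + y′ * (z′ - m⁻¹)
    cong₃ refl refl refl = refl

  X-diag : ∀ {c₀ r₀} → (∀ t → C t t ≡ c₀) → (∀ t → R t t ≡ r₀) → ∀ u → X u u ≡ c₀ * m⁻¹ + r₀ * (1ℚ - m⁻¹)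
  X-diag C-diag R-diag u =
    cong₂ (λ x y → x * m⁻¹ + y) (C-diag (base u)) (cong₂ (λ r d → r * (d - m⁻¹)) (R-diag (base u)) (δ-refl (fibre u)))

  Σℚ-X-column : (∀ s → Σℚ (λ t → C t s) ≡ 0ℚ) → ∀ w → Σℚ (λ v → X v w) ≡ 0ℚ
  Σℚ-X-column Σ-C-column w = begin
    Σℚ (λ v → X v w)                                   ≡⟨ Σℚ-pairs (λ t a → kernel t a (base w) (fibre w)) ⟩
    Σℚ (λ t → Σℚ (λ a → kernel t a (base w) (fibre w))) ≡⟨ Σℚ-cong (λ t → Σℚ-kernel-fibre t (base w) (fibre w)) ⟩
    Σℚ (λ t → C t (base w))                            ≡⟨ Σ-C-column (base w) ⟩
    0ℚ                                                 ∎
    where open ≡-Reasoning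

-- Cycles and circulant kernels

module Cycle (n : ℕ) where

  prev : Fin (suc n) → Fin (suc n)
  prev zero    = Fin.fromℕ n
  prev (suc i) = Fin.inject₁ i

  cycle : Fin (suc n) → Fin (suc n) → Bool
  cycle t s = isYes (t ≟ prev s) ∨ isYes (s ≟ prev t)

  cycle-sym : ∀ t s → cycle t s ≡ cycle s t
  cycle-sym t s = ∨-comm (isYes (t ≟ prev s)) (isYes (s ≟ prev t))

  prev≢id : 1 ℕ.≤ n → ∀ t → prev t ≢ t
  prev≢id 1≤n zero    prev≡ = ℕₚ.<-irrefl (sym (trans (sym (Finₚ.toℕ-fromℕ n)) (cong toℕ prev≡))) 1≤n
  prev≢id 1≤n (suc i) prev≡ = ℕₚ.<-irrefl (trans (sym (Finₚ.toℕ-inject₁ i)) (cong toℕ prev≡)) (ℕₚ.n<1+n (toℕ i))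

  cycle≡true⇔ : ∀ t s → cycle t s ≡ true ⇔ (t ≡ prev s ⊎ s ≡ prev t)
  cycle≡true⇔ t s with t ≟ prev s | s ≟ prev t
  ... | yes t≡ | _     = mk⇔ (λ _ → inj₁ t≡) (λ _ → refl)
  ... | no _   | yes s≡ = mk⇔ (λ _ → inj₂ s≡) (λ _ → refl)
  ... | no t≢  | no s≢  = mk⇔ (λ ()) [ ⊥-elim ∘ t≢ , ⊥-elim ∘ s≢ ]′

  Σℚ-prev : ∀ (f : Fin (suc n) → ℚ) → Σℚ (f ∘ prev) ≡ Σℚ f
  Σℚ-prev f = begin
    f (Fin.fromℕ n) + Σℚ (f ∘ Fin.inject₁)   ≡⟨ +-comm (f (Fin.fromℕ n)) _ ⟩
    Σℚ (f ∘ Fin.inject₁) + f (Fin.fromℕ n)   ≡⟨ cong₂ _+_ (Σℚ≡sum (f ∘ Fin.inject₁)) refl ⟩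
    Sum.sum (f ∘ Fin.inject₁) + f (Fin.fromℕ n) ≡⟨ sym (Sum.sum-init-last f) ⟩
    Sum.sum f                                ≡⟨ sym (Σℚ≡sum f) ⟩
    Σℚ f                                     ∎
    where open ≡-Reasoning

  prev²≢id : 2 ℕ.≤ n → ∀ t → prev (prev t) ≢ t
  prev²≢id (s≤s (s≤s z≤n)) zero          = λ ()
  prev²≢id (s≤s (s≤s z≤n)) (suc zero)    = λ ()
  prev²≢id (s≤s (s≤s z≤n)) (suc (suc i)) = λ e →
    ℕₚ.<-irrefl (sym (trans (sym (cong toℕ e)) (trans (Finₚ.toℕ-inject₁ _) (Finₚ.toℕ-inject₁ i))))
                (ℕₚ.<-trans (ℕₚ.n<1+n (toℕ i)) (ℕₚ.n<1+n (suc (toℕ i))))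

  module _ (2≤n : 2 ℕ.≤ n) where

    toℚ-cycle : ∀ t s → toℚ (cycle t s) ≡ δ t (prev s) + δ s (prev t)
    toℚ-cycle t s with t ≟ prev s | s ≟ prev t
    ... | yes t≡prev-s | yes s≡prev-t = ⊥-elim (prev²≢id 2≤n t (sym (trans t≡prev-s (cong prev s≡prev-t))))
    ... | yes _ | no _  = refl
    ... | no _  | yes _ = refl
    ... | no _  | no _  = refl

    Σℚ-cycle-neighbours : ∀ t {F F′ : Fin (suc n) → ℚ} → (∀ r → F r ≡ F′ (prev r)) →
                          Σℚ (λ r → toℚ (cycle t r) * F r) ≡ F′ t + F (prev t)
    Σℚ-cycle-neighbours t {F} {F′} F≡F′∘prev = begin
      Σℚ (λ r → toℚ (cycle t r) * F r)
        ≡⟨ Σℚ-cong (λ r → trans (cong (_* F r) (toℚ-cycle t r)) (*-distribʳ-+ (F r) (δ t (prev r)) (δ r (prev t)))) ⟩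
      Σℚ (λ r → δ t (prev r) * F r + δ r (prev t) * F r)
        ≡⟨ Σℚ-distrib-+ (λ r → δ t (prev r) * F r) (λ r → δ r (prev t) * F r) ⟩
      Σℚ (λ r → δ t (prev r) * F r) + Σℚ (λ r → δ r (prev t) * F r)
        ≡⟨ cong₂ _+_ (Σℚ-cong (λ r → cong (δ t (prev r) *_) (F≡F′∘prev r)))
                     (Σℚ-cong (λ r → cong (_* F r) (δ-sym r (prev t)))) ⟩
      Σℚ ((λ r → δ t r * F′ r) ∘ prev) + Σℚ (λ r → δ (prev t) r * F r)
        ≡⟨ cong₂ _+_ (trans (Σℚ-prev (λ r → δ t r * F′ r)) (Σℚ-δ t F′)) (Σℚ-δ (prev t) F) ⟩
      F′ t + F (prev t) ∎
      where open ≡-Reasoning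

    degree-cycle : ∀ t → degree cycle t ≡ 1ℚ + 1ℚ
    degree-cycle t = trans (Σℚ-cong (λ r → sym (*-identityʳ (toℚ (cycle t r)))))
                           (Σℚ-cycle-neighbours t {λ _ → 1ℚ} {λ _ → 1ℚ} (λ _ → refl))

    laplacian-cycle : ∀ (M : Mat (suc n)) → (∀ t s → M (prev t) (prev s) ≡ M t s) →
                      ∀ t s → (Laplacian cycle ⊗ M) t s ≡ (1ℚ + 1ℚ) * M t s - (M t (prev s) + M (prev t) s)
    laplacian-cycle M M-prev t s = begin
      (Laplacian cycle ⊗ M) t s
        ≡⟨ laplacian-apply cycle t (λ r → M r s) ⟩
      degree cycle t * M t s - Σℚ (λ r → toℚ (cycle t r) * M r s)
        ≡⟨ cong₂ (λ D S → D * M t s - S) (degree-cycle t)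
                 (Σℚ-cycle-neighbours t {λ r → M r s} {λ r → M r (prev s)} (λ r → sym (M-prev r s))) ⟩
      (1ℚ + 1ℚ) * M t s - (M t (prev s) + M (prev t) s) ∎
      where open ≡-Reasoning

-- By G-sym, K t s = G ∣ t - s ∣ depends only on the distance of t and s along the cycle.
module Circulant (n : ℕ) (G : ℕ → ℚ) (G-sym : ∀ x → x ℕ.≤ suc n → G (suc n ℕ.∸ x) ≡ G x) where
  open Cycle n

  K : Mat (suc n)
  K t s = G ∣ toℕ t - toℕ s ∣

  K-sym : ∀ t s → K t s ≡ K s t
  K-sym t s = cong G (ℕₚ.∣-∣-comm (toℕ t) (toℕ s))

  K-diag : ∀ t → K t t ≡ G 0
  K-diag t = cong G (ℕₚ.∣n-n∣≡0 (toℕ t))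

  G-reflect : ∀ {x} → x ℕ.≤ n → G (n ℕ.∸ x) ≡ G (suc x)
  G-reflect x≤n = G-sym _ (s≤s x≤n)

  G-∣last-x∣ : ∀ {x} → x ℕ.≤ n → G ∣ toℕ (Fin.fromℕ n) - x ∣ ≡ G (suc x)
  G-∣last-x∣ {x} x≤n = trans (cong (λ y → G ∣ y - x ∣) (Finₚ.toℕ-fromℕ n))
                             (trans (cong G (ℕₚ.m≤n⇒∣n-m∣≡n∸m x≤n)) (G-reflect x≤n))

  K-prev : ∀ t s → K (prev t) (prev s) ≡ K t s
  K-prev zero    zero    = cong G (ℕₚ.∣n-n∣≡0 (toℕ (Fin.fromℕ n)))
  K-prev zero    (suc j) = trans (cong (λ y → G ∣ toℕ (Fin.fromℕ n) - y ∣) (Finₚ.toℕ-inject₁ j))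
                                 (G-∣last-x∣ (ℕₚ.<⇒≤ (Finₚ.toℕ<n j)))
  K-prev (suc i) zero    = trans (K-sym (prev (suc i)) (prev zero)) (K-prev zero (suc i))
  K-prev (suc i) (suc j) = cong₂ (λ x y → G ∣ x - y ∣) (Finₚ.toℕ-inject₁ i) (Finₚ.toℕ-inject₁ j)

  Σℚ-K-column : ∀ s → Σℚ (λ t → K t s) ≡ Σℚ (λ t → K t zero)
  Σℚ-K-column = <-weakInduction (λ s → S s ≡ S zero) refl (λ i S[i]≡S[0] → trans (sym (S-prev (suc i))) S[i]≡S[0])
    where
    S : Fin (suc n) → ℚ
    S s = Σℚ (λ t → K t s)
    S-prev : ∀ s → S (prev s) ≡ S s
    S-prev s = trans (sym (Σℚ-prev (λ t → K t (prev s)))) (Σℚ-cong (λ t → K-prev t s))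

  jump : ℚ → ℚ → ℚ
  jump μ κ = μ * G 0 - (G 1 + G 1) - κ

  module _ (μ κ : ℚ) (G-rec : ∀ x → suc (suc x) ℕ.≤ suc n → μ * G (suc x) - (G x + G (suc (suc x))) ≡ κ) where

    private
      Φ : ℕ → ℕ → ℕ → ℚ
      Φ a b c = μ * G a - (G b + G c)

      Φ-cong : ∀ {a b c a′ b′ c′} → G a ≡ G a′ → G b ≡ G b′ → G c ≡ G c′ → Φ a b c ≡ Φ a′ b′ c′
      Φ-cong p q r = cong₂ (λ x y → μ * x - y) p (cong₂ _+_ q r)

      Δ : ℕ → ℕ → ℚ
      Δ x y = Φ ∣ x - y ∣ ∣ suc x - y ∣ ∣ x - suc y ∣

      Δ-sym : ∀ x y → Δ x y ≡ Δ y x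
      Δ-sym x y = trans (cong (λ b → μ * G ∣ x - y ∣ - b) (+-comm (G ∣ suc x - y ∣) _))
                        (Φ-cong (cong G (ℕₚ.∣-∣-comm x y)) (cong G (ℕₚ.∣-∣-comm x (suc y))) (cong G (ℕₚ.∣-∣-comm (suc x) y)))

      Δ-+ : ∀ x D → x ℕ.+ suc D ℕ.< n → Δ x (x ℕ.+ suc D) ≡ κ
      Δ-+ x D x+1+D<n = begin
        Δ x (x ℕ.+ suc D)
          ≡⟨ Φ-cong (cong G (ℕₚ.∣m-m+n∣≡n x (suc D)))
                    (cong G (trans (cong (∣ suc x -_∣) (ℕₚ.+-suc x D)) (ℕₚ.∣m-m+n∣≡n (suc x) D)))
                    (cong G (trans (cong ∣ x -_∣ (sym (ℕₚ.+-suc x (suc D)))) (ℕₚ.∣m-m+n∣≡n x (suc (suc D))))) ⟩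
        Φ (suc D) D (suc (suc D))
          ≡⟨ G-rec D (ℕₚ.≤-trans (ℕₚ.m≤n+m (suc (suc D)) x)
                                 (ℕₚ.≤-trans (ℕₚ.≤-reflexive (ℕₚ.+-suc x (suc D))) (ℕₚ.m≤n⇒m≤1+n x+1+D<n))) ⟩
        κ ∎
        where open ≡-Reasoning

      Δ-< : ∀ {x y} → x ℕ.< y → y ℕ.< n → Δ x y ≡ κ
      Δ-< {x} {y} x<y y<n = trans (cong (Δ x) y≡x+1+D) (Δ-+ x D (subst (ℕ._< n) y≡x+1+D y<n))
        where
        D = y ℕ.∸ suc x
        y≡x+1+D : y ≡ x ℕ.+ suc D
        y≡x+1+D = sym (trans (ℕₚ.+-suc x D) (ℕₚ.m+[n∸m]≡n x<y))

      ∣x-1+x∣≡1 : ∀ x → ∣ x - suc x ∣ ≡ 1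
      ∣x-1+x∣≡1 zero    = refl
      ∣x-1+x∣≡1 (suc x) = ∣x-1+x∣≡1 x

      Δ-diag : ∀ x → Δ x x ≡ Φ 0 1 1
      Δ-diag x = Φ-cong (cong G (ℕₚ.∣n-n∣≡0 x)) (cong G (trans (ℕₚ.∣-∣-comm (suc x) x) (∣x-1+x∣≡1 x))) (cong G (∣x-1+x∣≡1 x))

      on-diagonal : ∀ {m} (i : Fin m) → Φ 0 1 1 ≡ δ i i * jump μ κ + κ
      on-diagonal i = trans (lemma (Φ 0 1 1) κ) (cong (λ d → d * jump μ κ + κ) (sym (δ-refl i)))
        where
        lemma : ∀ a k → a ≡ 1ℚ * (a - k) + k
        lemma = solve-∀ ring

      off-diagonal : ∀ {m} {i j : Fin m} → i ≢ j → κ ≡ δ i j * jump μ κ + κ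
      off-diagonal i≢j =
        trans (sym (+-identityˡ κ)) (cong (_+ κ) (trans (sym (*-zeroˡ (jump μ κ))) (cong (_* jump μ κ) (sym (δ-≢ i≢j)))))

      Δ-interior : ∀ (i j : Fin n) → Δ (toℕ i) (toℕ j) ≡ δ i j * jump μ κ + κ
      Δ-interior i j with ℕₚ.<-cmp (toℕ i) (toℕ j)
      ... | tri< x<y _ _ = trans (Δ-< x<y (Finₚ.toℕ<n j)) (off-diagonal (Finₚ.<⇒≢ x<y))
      ... | tri> _ _ x>y = trans (Δ-sym (toℕ i) (toℕ j)) (trans (Δ-< x>y (Finₚ.toℕ<n i)) (off-diagonal (Finₚ.<⇒≢ x>y ∘ sym)))
      ... | tri≈ _ x≡y _ with refl ← Finₚ.toℕ-injective x≡y = trans (Δ-diag (toℕ i)) (on-diagonal i)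

      Ψ : Fin (suc n) → Fin (suc n) → ℚ
      Ψ t s = μ * K t s - (K t (prev s) + K (prev t) s)

      Ψ-sym : ∀ t s → Ψ t s ≡ Ψ s t
      Ψ-sym t s = cong₂ (λ a b → μ * a - b) (K-sym t s)
                        (trans (+-comm (K t (prev s)) _) (cong₂ _+_ (K-sym (prev t) s) (K-sym t (prev s))))

      K-rec : ∀ t s → Ψ t s ≡ δ t s * jump μ κ + κ
      K-rec zero    zero    = trans (Φ-cong refl G-∣0-last∣ (G-∣last-x∣ z≤n)) (on-diagonal {suc n} zero)
        where
        G-∣0-last∣ : G ∣ 0 - toℕ (Fin.fromℕ n) ∣ ≡ G 1
        G-∣0-last∣ = trans (cong G (ℕₚ.∣-∣-comm 0 _)) (G-∣last-x∣ z≤n)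
      K-rec zero    (suc j) = trans (Φ-cong refl (cong G (Finₚ.toℕ-inject₁ j)) (G-∣last-x∣ (Finₚ.toℕ<n j)))
                                    (trans (G-rec (toℕ j) (s≤s (Finₚ.toℕ<n j))) (off-diagonal {i = zero} {suc j} (λ ())))
      K-rec (suc i) zero    = trans (Ψ-sym (suc i) zero)
                                    (trans (K-rec zero (suc i)) (cong (λ d → d * jump μ κ + κ) (δ-sym zero (suc i))))
      K-rec (suc i) (suc j) = begin
        Ψ (suc i) (suc j)        ≡⟨ Φ-cong refl (cong (λ y → G ∣ suc (toℕ i) - y ∣) (Finₚ.toℕ-inject₁ j))
                                                (cong (λ x → G ∣ x - suc (toℕ j) ∣) (Finₚ.toℕ-inject₁ i)) ⟩
        Δ (toℕ i) (toℕ j)        ≡⟨ Δ-interior i j ⟩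
        δ i j * jump μ κ + κ            ≡⟨ cong (λ d → d * jump μ κ + κ) (sym (δ-suc i j)) ⟩
        δ (suc i) (suc j) * jump μ κ + κ ∎
        where open ≡-Reasoning

    laplacian-circulant : 2 ℕ.≤ n → jump μ κ ≡ 1ℚ →
                          ∀ t s → (Laplacian cycle ⊗ K) t s + (μ - (1ℚ + 1ℚ)) * K t s ≡ δ t s + κ
    laplacian-circulant 2≤n jump≡1 t s = begin
      (Laplacian cycle ⊗ K) t s + (μ - (1ℚ + 1ℚ)) * K t s
        ≡⟨ cong (_+ (μ - (1ℚ + 1ℚ)) * K t s) (laplacian-cycle 2≤n K K-prev t s) ⟩
      (1ℚ + 1ℚ) * K t s - (K t (prev s) + K (prev t) s) + (μ - (1ℚ + 1ℚ)) * K t s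
        ≡⟨ lemma μ (K t s) (K t (prev s) + K (prev t) s) ⟩
      Ψ t s
        ≡⟨ K-rec t s ⟩
      δ t s * jump μ κ + κ
        ≡⟨ cong (λ e → δ t s * e + κ) jump≡1 ⟩
      δ t s * 1ℚ + κ
        ≡⟨ cong (_+ κ) (*-identityʳ (δ t s)) ⟩
      δ t s + κ ∎
      where
      open ≡-Reasoning
      lemma : ∀ μ k s → (1ℚ + 1ℚ) * k - s + (μ - (1ℚ + 1ℚ)) * k ≡ μ * k - s
      lemma = solve-∀ ring

module CycleKernels (n : ℕ) (2≤n : 2 ℕ.≤ n) where
  open Cycle n

  N⁻¹ : ℚ
  N⁻¹ = 1/[1+ n ]

  -- The second difference of x (N − x) is constant, so C = g ∣ t - s ∣ inverts the cycle
  -- Laplacian on the sums-zero vectors; H₀, the column mean of h, makes its columns sum to zero.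
  h : ℕ → ℚ
  h x = fromℕ x * (fromℕ (suc n) - fromℕ x)

  h-sym : ∀ x → x ℕ.≤ suc n → h (suc n ℕ.∸ x) ≡ h x
  h-sym x x≤N = trans (cong (λ y → y * (fromℕ (suc n) - y)) (fromℕ-∸ x≤N)) (lemma (fromℕ (suc n)) (fromℕ x))
    where
    lemma : ∀ a b → (a - b) * (a - (a - b)) ≡ b * (a - b)
    lemma = solve-∀ ring

  h-rec : ∀ x → (1ℚ + 1ℚ) * h (suc x) - (h x + h (suc (suc x))) ≡ 1ℚ + 1ℚ
  h-rec x = lemma (fromℕ (suc n)) (fromℕ x)
    where
    lemma : ∀ a b → (1ℚ + 1ℚ) * ((1ℚ + b) * (a - (1ℚ + b))) - (b * (a - b) + (1ℚ + (1ℚ + b)) * (a - (1ℚ + (1ℚ + b)))) ≡ 1ℚ + 1ℚ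
    lemma = solve-∀ ring

  H₀ : ℚ
  H₀ = N⁻¹ * Σℚ {suc n} (λ t → h ∣ toℕ t - 0 ∣)

  g : ℕ → ℚ
  g x = (H₀ - h x) * (½ * N⁻¹)

  g-sym : ∀ x → x ℕ.≤ suc n → g (suc n ℕ.∸ x) ≡ g x
  g-sym x x≤N = cong (λ y → (H₀ - y) * (½ * N⁻¹)) (h-sym x x≤N)

  g-rec : ∀ x → suc (suc x) ℕ.≤ suc n → (1ℚ + 1ℚ) * g (suc x) - (g x + g (suc (suc x))) ≡ - N⁻¹
  g-rec x _ = begin
    (1ℚ + 1ℚ) * g (suc x) - (g x + g (suc (suc x)))
      ≡⟨ lemma H₀ (h x) (h (suc x)) (h (suc (suc x))) (½ * N⁻¹) ⟩
    ((1ℚ + 1ℚ) * h (suc x) - (h x + h (suc (suc x)))) * - (½ * N⁻¹)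
      ≡⟨ cong (_* - (½ * N⁻¹)) (h-rec x) ⟩
    (1ℚ + 1ℚ) * - (½ * N⁻¹)
      ≡⟨ halve N⁻¹ ⟩
    - N⁻¹ ∎
    where
    open ≡-Reasoning
    lemma : ∀ H a b c f → (1ℚ + 1ℚ) * ((H - b) * f) - ((H - a) * f + (H - c) * f) ≡ ((1ℚ + 1ℚ) * b - (a + c)) * - f
    lemma = solve-∀ ring
    halve : ∀ i → (1ℚ + 1ℚ) * - (½ * i) ≡ - i
    halve = solve-∀ ring

  module CirculantC = Circulant n g g-sym

  C : Mat (suc n)
  C = CirculantC.K

  jump-g : CirculantC.jump (1ℚ + 1ℚ) (- N⁻¹) ≡ 1ℚ
  jump-g = trans (lemma H₀ (fromℕ (suc n)) N⁻¹) (*-1/[1+ n ])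
    where
    lemma : ∀ H a i → (1ℚ + 1ℚ) * ((H - 0ℚ * (a - 0ℚ)) * (½ * i))
                        - ((H - (1ℚ + 0ℚ) * (a - (1ℚ + 0ℚ))) * (½ * i) + (H - (1ℚ + 0ℚ) * (a - (1ℚ + 0ℚ))) * (½ * i))
                        - - i ≡ a * i
    lemma = solve-∀ ring

  laplacian-C : ∀ t s → (Laplacian cycle ⊗ C) t s ≡ δ t s - N⁻¹
  laplacian-C t s = trans (sym (lemma ((Laplacian cycle ⊗ C) t s) (C t s)))
                          (CirculantC.laplacian-circulant (1ℚ + 1ℚ) (- N⁻¹) g-rec 2≤n jump-g t s)
    where
    lemma : ∀ x c → x + ((1ℚ + 1ℚ) - (1ℚ + 1ℚ)) * c ≡ x
    lemma = solve-∀ ring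

  Σℚ-C-column : ∀ s → Σℚ (λ t → C t s) ≡ 0ℚ
  Σℚ-C-column s = begin
    Σℚ (λ t → C t s)
      ≡⟨ CirculantC.Σℚ-K-column s ⟩
    Σℚ (λ t → (H₀ - h (d t)) * (½ * N⁻¹))
      ≡⟨ Σℚ-cong (λ t → split H₀ (h (d t)) (½ * N⁻¹)) ⟩
    Σℚ (λ t → H₀ * (½ * N⁻¹) + h (d t) * - (½ * N⁻¹))
      ≡⟨ Σℚ-linear (λ _ → H₀) (λ t → h (d t)) (½ * N⁻¹) (- (½ * N⁻¹)) ⟩
    Σℚ {suc n} (λ _ → H₀) * (½ * N⁻¹) + S * - (½ * N⁻¹)
      ≡⟨ cong (λ x → x * (½ * N⁻¹) + S * - (½ * N⁻¹)) (Σℚ-const (suc n) H₀) ⟩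
    fromℕ (suc n) * (N⁻¹ * S) * (½ * N⁻¹) + S * - (½ * N⁻¹)
      ≡⟨ regroup (fromℕ (suc n)) N⁻¹ S ⟩
    (fromℕ (suc n) * N⁻¹ - 1ℚ) * S * (½ * N⁻¹)
      ≡⟨ cong (λ x → (x - 1ℚ) * S * (½ * N⁻¹)) (*-1/[1+ n ]) ⟩
    (1ℚ - 1ℚ) * S * (½ * N⁻¹)
      ≡⟨ cancel S N⁻¹ ⟩
    0ℚ ∎
    where
    open ≡-Reasoning
    d : Fin (suc n) → ℕ
    d t = ∣ toℕ t - 0 ∣
    S = Σℚ (λ t → h (d t))
    split : ∀ H x f → (H - x) * f ≡ H * f + x * - f
    split = solve-∀ ring
    regroup : ∀ a i S → a * (i * S) * (½ * i) + S * - (½ * i) ≡ (a * i - 1ℚ) * S * (½ * i)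
    regroup = solve-∀ ring
    cancel : ∀ S i → (1ℚ - 1ℚ) * S * (½ * i) ≡ 0ℚ
    cancel = solve-∀ ring

  module Resolvent (e : ℕ) where

    μ : ℚ
    μ = fromℕ (suc (suc (suc e)))

    U : ℕ → ℚ
    U zero          = 0ℚ
    U (suc zero)    = 1ℚ
    U (suc (suc x)) = μ * U (suc x) - U x

    U-growth : ∀ x → 0ℚ ≤ U x × 0ℚ ≤ U (suc x) - U x - 1ℚ
    0<U[1+x] : ∀ x → 0ℚ < U (suc x)

    U-growth zero    = ≤-refl , ≤-refl
    U-growth (suc x) = <⇒≤ (0<U[1+x] x) ,
      subst (0ℚ ≤_) (sym (step (fromℕ e) (U x) (U (suc x))))
            (0≤-+ (0≤-* (0≤fromℕ (suc e)) (<⇒≤ (0<U[1+x] x))) (proj₂ (U-growth x)))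
      where
      step : ∀ ê a b → (1ℚ + (1ℚ + (1ℚ + ê))) * b - a - b - 1ℚ ≡ (1ℚ + ê) * b + (b - a - 1ℚ)
      step = solve-∀ ring

    0<U[1+x] x = subst (0ℚ <_) (sym (telescope (U x) (U (suc x))))
                       (0<-+ (positive⁻¹ 1ℚ) (0≤-+ (proj₁ (U-growth x)) (proj₂ (U-growth x))))
      where
      telescope : ∀ a b → b ≡ 1ℚ + (a + (b - a - 1ℚ))
      telescope = solve-∀ ring

    -- Q solves the recurrence of U and is symmetric under x ↦ N − x, so R = Q ∣ t - s ∣ / D
    -- inverts L + m for μ = m + 2 once D is the value of (L + m) (Q ∣ t - s ∣) on the diagonal.
    Q : ℕ → ℚ
    Q x = U x + U (suc n ℕ.∸ x)

    Q-sym : ∀ x → x ℕ.≤ suc n → Q (suc n ℕ.∸ x) ≡ Q x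
    Q-sym x x≤N = trans (cong (U (suc n ℕ.∸ x) +_) (cong U (ℕₚ.m∸[m∸n]≡n x≤N))) (+-comm (U (suc n ℕ.∸ x)) (U x))

    Q-rec : ∀ x → suc (suc x) ℕ.≤ suc n → μ * Q (suc x) - (Q x + Q (suc (suc x))) ≡ 0ℚ
    Q-rec x 2+x≤N = begin
      μ * (U (suc x) + U (suc n ℕ.∸ suc x)) - ((U x + U (suc n ℕ.∸ x)) + (U (suc (suc x)) + U y))
        ≡⟨ cong₂ (λ a b → μ * (U (suc x) + U a) - ((U x + U b) + (U (suc (suc x)) + U y))) N-1-x≡1+y N-x≡2+y ⟩
      μ * (U (suc x) + U (suc y)) - ((U x + U (suc (suc y))) + (U (suc (suc x)) + U y))
        ≡⟨ lemma μ (U x) (U (suc x)) (U y) (U (suc y)) ⟩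
      0ℚ ∎
      where
      open ≡-Reasoning
      y = suc n ℕ.∸ suc (suc x)
      N-1-x≡1+y : suc n ℕ.∸ suc x ≡ suc y
      N-1-x≡1+y = ℕₚ.+-∸-assoc 1 2+x≤N
      N-x≡2+y : suc n ℕ.∸ x ≡ suc (suc y)
      N-x≡2+y = trans (ℕₚ.+-∸-assoc 1 (ℕₚ.≤-trans (ℕₚ.n≤1+n (suc x)) 2+x≤N)) (cong suc N-1-x≡1+y)
      lemma : ∀ μ a b c d → μ * (b + d) - ((a + (μ * d - c)) + ((μ * b - a) + c)) ≡ 0ℚ
      lemma = solve-∀ ring

    D : ℚ
    D = μ * Q 0 - (Q 1 + Q 1)

    -- D = m U N + 2 (U N − U n − 1), and m ≥ 1.
    0<D : 0ℚ < D
    0<D = subst (0ℚ <_) (sym (expand (fromℕ e) (U n) (U (suc n))))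
                (0<-+ (0<-* (0<fromℕ-suc e) (0<U[1+x] n)) (0≤-* (0≤fromℕ 2) (proj₂ (U-growth n))))
      where
      expand : ∀ ê a b → (1ℚ + (1ℚ + (1ℚ + ê))) * (0ℚ + b) - ((1ℚ + a) + (1ℚ + a)) ≡ (1ℚ + ê) * b + (1ℚ + (1ℚ + 0ℚ)) * (b - a - 1ℚ)
      expand = solve-∀ ring

    D⁻¹ : ℚ
    D⁻¹ = (1/ D) {{pos⇒nonZero D {{ℚ.positive 0<D}}}}

    q : ℕ → ℚ
    q x = Q x * D⁻¹

    q-sym : ∀ x → x ℕ.≤ suc n → q (suc n ℕ.∸ x) ≡ q x
    q-sym x x≤N = cong (_* D⁻¹) (Q-sym x x≤N)

    q-rec : ∀ x → suc (suc x) ℕ.≤ suc n → μ * q (suc x) - (q x + q (suc (suc x))) ≡ 0ℚ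
    q-rec x 2+x≤N = trans (factor μ (Q x) (Q (suc x)) (Q (suc (suc x))) D⁻¹)
                          (trans (cong (_* D⁻¹) (Q-rec x 2+x≤N)) (*-zeroˡ D⁻¹))
      where
      factor : ∀ μ a b c i → μ * (b * i) - (a * i + c * i) ≡ (μ * b - (a + c)) * i
      factor = solve-∀ ring

    module CirculantR = Circulant n q q-sym

    R : Mat (suc n)
    R = CirculantR.K

    jump-q : CirculantR.jump μ 0ℚ ≡ 1ℚ
    jump-q = trans (factor μ (Q 0) (Q 1) D⁻¹) (*-inverseʳ D {{pos⇒nonZero D {{ℚ.positive 0<D}}}})
      where
      factor : ∀ μ a b i → μ * (a * i) - (b * i + b * i) - 0ℚ ≡ (μ * a - (b + b)) * i
      factor = solve-∀ ring

    laplacian-R : ∀ t s → (Laplacian cycle ⊗ R) t s + fromℕ (suc e) * R t s ≡ δ t s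
    laplacian-R t s = begin
      (Laplacian cycle ⊗ R) t s + fromℕ (suc e) * R t s
        ≡⟨ cong (λ x → (Laplacian cycle ⊗ R) t s + x * R t s) (shift (fromℕ e)) ⟩
      (Laplacian cycle ⊗ R) t s + (μ - (1ℚ + 1ℚ)) * R t s
        ≡⟨ CirculantR.laplacian-circulant μ 0ℚ q-rec 2≤n jump-q t s ⟩
      δ t s + 0ℚ
        ≡⟨ +-identityʳ (δ t s) ⟩
      δ t s ∎
      where
      open ≡-Reasoning
      shift : ∀ ê → 1ℚ + ê ≡ (1ℚ + (1ℚ + (1ℚ + ê))) - (1ℚ + 1ℚ)
      shift = solve-∀ ring

module _ (n : ℕ) (2≤n : 2 ℕ.≤ n) (e : ℕ) where
  open Cycle n
  open CycleKernels n 2≤n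
  open Resolvent e
  open □K-Kernel cycle (suc e) 1/[1+ e ] (*-1/[1+ e ]) C R

  cycle□K-resistance-positive :
    ∃ λ (X : Mat (suc n ℕ.* suc e)) → IsMoorePenrose (Laplacian (cycle □K[ suc e ])) X ×
                                       (∀ v → 0ℚ < curvature (cycle □K[ suc e ]) X v)
  cycle□K-resistance-positive =
    X ,
    isMoorePenrose (cycle □K[ suc e ]) A-sym X c X-sym′ LX (Σℚ-X-column Σℚ-C-column) ,
    λ v → subst (0ℚ <_) (sym (curvature-≡ (cycle □K[ suc e ]) A-sym X c X-sym′ LX (X-diag CirculantC.K-diag CirculantR.K-diag) v))
                (0<-* (0<1/[1+ n ]) (0<1/[1+ e ]))
    where
    c = N⁻¹ * 1/[1+ e ]
    A-sym = □K-Graph.□K-sym cycle (suc e) cycle-sym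
    X-sym′ = X-sym CirculantC.K-sym CirculantR.K-sym
    LX = laplacian-X N⁻¹ laplacian-C laplacian-R

-- Exposed faces and products of point sets

Exposes : ∀ {d} {I : Set} → (I → Point d) → (I → Set) → Set
Exposes {d} p Z = ∃ λ (c : Point d) → ∃ λ (b : ℚ) → ∀ i → (c · p i ≤ b) × (c · p i ≡ b ⇔ Z i)

Spanning : ∀ {d} {I : Set} → (I → Point d) → Set
Spanning {d} p = ∀ (c : Point d) → (∀ i j → c · p i ≡ c · p j) → ∀ k → c k ≡ 0ℚ

module _ {d} {I : Set} {p : I → Point d} where

  exposes-by-gap : ∀ {Z : I → Set} (c : Point d) (b : ℚ) (gap : I → ℚ) →
                   (∀ i → c · p i + gap i ≡ b) → (∀ i → 0ℚ ≤ gap i) → (∀ i → gap i ≡ 0ℚ ⇔ Z i) → Exposes p Z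
  exposes-by-gap c b gap sum≡b 0≤gap gap≡0⇔Z = c , b , λ i →
    subst (_≤ b) (+-identityʳ (c · p i)) (subst (c · p i + 0ℚ ≤_) (sum≡b i) (+-monoʳ-≤ (c · p i) (0≤gap i))) ,
    mk⇔ (λ c·p≡b → Equivalence.to (gap≡0⇔Z i)
                     (+-cancelˡ (c · p i) (gap i) 0ℚ (trans (sum≡b i) (trans (sym c·p≡b) (sym (+-identityʳ _))))))
        (λ Zi → trans (sym (+-identityʳ (c · p i)))
                      (trans (cong (c · p i +_) (sym (Equivalence.from (gap≡0⇔Z i) Zi))) (sum≡b i)))

  exposes-⇔ : ∀ {Z Z′ : I → Set} → (∀ i → Z i ⇔ Z′ i) → Exposes p Z → Exposes p Z′
  exposes-⇔ Z⇔Z′ (c , b , h) = c , b , λ i → proj₁ (h i) , ⇔-trans (proj₂ (h i)) (Z⇔Z′ i)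

  exposed-point⇒vertex : ∀ {i} → Exposes p (_≡ i) → ∃ λ (c : Point d) → ∀ j → j ≢ i → c · p j < c · p i
  exposed-point⇒vertex {i} (c , b , h) = c , λ j j≢i →
    subst (c · p j <_) (sym (Equivalence.from (proj₂ (h i)) refl))
          (≤∧≢⇒< (proj₁ (h j)) (j≢i ∘ Equivalence.to (proj₂ (h j))))

  exposes-reindex : ∀ {J : Set} {q : J → Point d} {Z : I → Set} (f : J → I) → (∀ j → p (f j) ≡ q j) →
                    Exposes p Z → Exposes q (Z ∘ f)
  exposes-reindex f p∘f≗q (c , b , h) = c , b , λ j → subst (λ x → (c · x ≤ b) × (c · x ≡ b ⇔ _)) (p∘f≗q j) (h (f j))

  spanning-reindex : ∀ {J : Set} {q : J → Point d} (g : J → I) → (∀ j → p (g j) ≡ q j) → Spanning q → Spanning p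
  spanning-reindex g p∘g≗q q-spanning c p-constant = q-spanning c λ j j′ →
    trans (cong (c ·_) (sym (p∘g≗q j))) (trans (p-constant (g j) (g j′)) (cong (c ·_) (p∘g≗q j′)))

  exposed-face-⊥ : ∀ {Z : I → Set} {k l i j} (wₖ wₗ wᵢ wⱼ : ℚ) → Exposes p Z → 0ℚ ≤ wₖ → 0ℚ < wₗ → wₖ + wₗ ≡ wᵢ + wⱼ →
                   (∀ c → wₖ * (c · p k) + wₗ * (c · p l) ≡ wᵢ * (c · p i) + wⱼ * (c · p j)) →
                   Z i → Z j → ¬ Z l → ⊥
  exposed-face-⊥ {k = k} {l} {i} {j} wₖ wₗ wᵢ wⱼ (c , b , h) 0≤wₖ 0<wₗ Σw≡Σw relation Zi Zj ¬Zl =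
    <-irrefl (relation c) (begin-strict
      wₖ * (c · p k) + wₗ * (c · p l) <⟨ +-mono-≤-< (*-monoˡ-≤-nonNeg wₖ {{ℚ.nonNegative 0≤wₖ}} (proj₁ (h k)))
                                                    (*-monoʳ-<-pos wₗ {{ℚ.positive 0<wₗ}} (≤∧≢⇒< (proj₁ (h l)) (¬Zl ∘ Equivalence.to (proj₂ (h l))))) ⟩
      wₖ * b + wₗ * b                 ≡⟨ sym (*-distribʳ-+ b wₖ wₗ) ⟩
      (wₖ + wₗ) * b                   ≡⟨ cong (_* b) Σw≡Σw ⟩
      (wᵢ + wⱼ) * b                   ≡⟨ *-distribʳ-+ b wᵢ wⱼ ⟩
      wᵢ * b + wⱼ * b                 ≡⟨ sym (cong₂ (λ x y → wᵢ * x + wⱼ * y) (Equivalence.from (proj₂ (h i)) Zi) (Equivalence.from (proj₂ (h j)) Zj)) ⟩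
      wᵢ * (c · p i) + wⱼ * (c · p j) ∎)
    where open ≤-Reasoning

strictly-separated⇒injective : ∀ {d n} {p : Fin n → Point d} →
  (∀ i → ∃ λ (c : Point d) → ∀ j → j ≢ i → c · p j < c · p i) → ∀ i j → p i ≡ p j → i ≡ j
strictly-separated⇒injective separated i j pi≡pj with i ≟ j
... | yes i≡j = i≡j
... | no i≢j  = ⊥-elim (<-irrefl (cong (proj₁ (separated j) ·_) pi≡pj) (proj₂ (separated j) i i≢j))

·-cong : ∀ {d} {c c′ : Point d} (x : Point d) → (∀ k → c k ≡ c′ k) → c · x ≡ c′ · x
·-cong x c≗c′ = Σℚ-cong (λ k → cong (_* x k) (c≗c′ k))

module _ {d₁ d₂ : ℕ} where

  ·-++ : ∀ (c : Point (d₁ ℕ.+ d₂)) (x : Point d₁) (y : Point d₂) →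
         c · (x ++ y) ≡ (c ∘ (_↑ˡ d₂)) · x + (c ∘ (d₁ ↑ʳ_)) · y
  ·-++ c x y = trans (Σℚ-↑ d₁ (λ k → c k * (x ++ y) k))
                     (cong₂ _+_ (Σℚ-cong (λ i → cong (c (i ↑ˡ d₂) *_) (lookup-++ˡ x y i)))
                                (Σℚ-cong (λ j → cong (c (d₁ ↑ʳ j) *_) (lookup-++ʳ x y j))))

  ++-·-++ : ∀ (c₁ x : Point d₁) (c₂ y : Point d₂) → (c₁ ++ c₂) · (x ++ y) ≡ c₁ · x + c₂ · y
  ++-·-++ c₁ x c₂ y = trans (·-++ (c₁ ++ c₂) x y) (cong₂ _+_ (·-cong x (lookup-++ˡ c₁ c₂)) (·-cong y (lookup-++ʳ c₁ c₂)))

  _⊕_ : ∀ {I J : Set} → (I → Point d₁) → (J → Point d₂) → I × J → Point (d₁ ℕ.+ d₂)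
  (p ⊕ q) (i , j) = p i ++ q j

  module _ {I J : Set} {p : I → Point d₁} {q : J → Point d₂} where

    exposes-⊕ : ∀ {Z₁ : I → Set} {Z₂ : J → Set} → Exposes p Z₁ → Exposes q Z₂ →
                Exposes (p ⊕ q) (λ x → Z₁ (proj₁ x) × Z₂ (proj₂ x))
    exposes-⊕ (c₁ , b₁ , h₁) (c₂ , b₂ , h₂) = c₁ ++ c₂ , b₁ + b₂ , λ { (i , j) →
      subst (_≤ b₁ + b₂) (sym (++-·-++ c₁ (p i) c₂ (q j))) (+-mono-≤ (proj₁ (h₁ i)) (proj₁ (h₂ j))) ,
      ⇔-trans (≡-⇔ˡ (++-·-++ c₁ (p i) c₂ (q j)))
              (⇔-trans (+-≡-+⇔ (proj₁ (h₁ i)) (proj₁ (h₂ j))) (proj₂ (h₁ i) ×-⇔ proj₂ (h₂ j))) }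

    exposes-slice : ∀ {Z : I × J → Set} → Exposes (p ⊕ q) Z → ∀ j → Exposes p (λ i → Z (i , j))
    exposes-slice (c , b , h) j = c ∘ (_↑ˡ d₂) , b - y , λ i →
      +-≤⇒≤- (subst (_≤ b) (·-++ c (p i) (q j)) (proj₁ (h (i , j)))) ,
      ⇔-trans (⇔-sym x+y≡z⇔x≡z-y) (⇔-trans (≡-⇔ˡ (sym (·-++ c (p i) (q j)))) (proj₂ (h (i , j))))
      where
      y = (c ∘ (d₁ ↑ʳ_)) · q j

    spanning-⊕ : Spanning p → Spanning q → I → J → Spanning (p ⊕ q)
    spanning-⊕ p-spanning q-spanning i₀ j₀ c constant k with Fin.splitAt d₁ k in split≡
    ... | inj₁ i = trans (cong c (sym (Finₚ.splitAt⁻¹-↑ˡ split≡))) (left≡0 i)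
      where
      left≡0 : ∀ i → c (i ↑ˡ d₂) ≡ 0ℚ
      left≡0 = p-spanning (c ∘ (_↑ˡ d₂)) λ i i′ →
        +-cancelʳ ((c ∘ (d₁ ↑ʳ_)) · q j₀) _ _
          (trans (sym (·-++ c (p i) (q j₀))) (trans (constant (i , j₀) (i′ , j₀)) (·-++ c (p i′) (q j₀))))
    ... | inj₂ j = trans (cong c (sym (Finₚ.splitAt⁻¹-↑ʳ split≡))) (right≡0 j)
      where
      right≡0 : ∀ j → c (d₁ ↑ʳ j) ≡ 0ℚ
      right≡0 = q-spanning (c ∘ (d₁ ↑ʳ_)) λ j j′ →
        +-cancelˡ ((c ∘ (_↑ˡ d₂)) · p i₀) _ _
          (trans (sym (·-++ c (p i₀) (q j))) (trans (constant (i₀ , j) (i₀ , j′)) (·-++ c (p i₀) (q j′))))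

module Simplex (e : ℕ) where

  corner : Fin (suc e) → Point e
  corner zero    _ = 0ℚ
  corner (suc a) j = δ a j

  ·-corner : ∀ (c : Point e) a → c · corner a ≡ (0ℚ ∷ c) a
  ·-corner c zero    = trans (Σℚ-cong (λ j → *-zeroʳ (c j))) (trans (Σℚ-const e 0ℚ) (*-zeroʳ (fromℕ e)))
  ·-corner c (suc a) = trans (Σℚ-cong (λ j → *-comm (c j) (δ a j))) (Σℚ-δ a c)

  subset-exposed : ∀ {Z : Fin (suc e) → Set} → Decidable Z → Exposes corner Z
  subset-exposed {Z} Z? = exposes-by-gap c (1ℚ - [Z] zero) gap sum≡ (λ a → 0≤1-toℚ (isYes (Z? a))) (λ a → gap≡0⇔ (Z? a))
    where
    [Z] : Fin (suc e) → ℚ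
    [Z] a = toℚ (isYes (Z? a))
    c : Point e
    c j = [Z] (suc j) - [Z] zero
    gap : Fin (suc e) → ℚ
    gap a = 1ℚ - [Z] a
    sum≡ : ∀ a → c · corner a + gap a ≡ 1ℚ - [Z] zero
    sum≡ zero    = trans (cong (_+ gap zero) (·-corner c zero)) (+-identityˡ (gap zero))
    sum≡ (suc a) = trans (cong (_+ gap (suc a)) (·-corner c (suc a))) (lemma ([Z] (suc a)) ([Z] zero))
      where
      lemma : ∀ x z → x - z + (1ℚ - x) ≡ 1ℚ - z
      lemma = solve-∀ ring
    0≤1-toℚ : ∀ b → 0ℚ ≤ 1ℚ - toℚ b
    0≤1-toℚ true  = ≤-refl
    0≤1-toℚ false = <⇒≤ (positive⁻¹ 1ℚ)
    gap≡0⇔ : ∀ {P} (P? : Dec P) → 1ℚ - toℚ (isYes P?) ≡ 0ℚ ⇔ P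
    gap≡0⇔ (yes p) = mk⇔ (λ _ → p) (λ _ → refl)
    gap≡0⇔ (no ¬p) = mk⇔ (λ ()) (λ p → ⊥-elim (¬p p))

  spanning : Spanning corner
  spanning c constant j = trans (sym (·-corner c (suc j))) (trans (constant (suc j) zero) (·-corner c zero))

-- Polygons on a parabola

fromℕ-gap≡0⇔ : ∀ r x y → (fromℕ r - fromℕ x) * (fromℕ r - fromℕ y) ≡ 0ℚ ⇔ (r ≡ x ⊎ r ≡ y)
fromℕ-gap≡0⇔ r x y = ⇔-trans *≡0⇔ ((⇔-trans -≡0⇔≡ fromℕ-≡⇔) ⊎-⇔ (⇔-trans -≡0⇔≡ fromℕ-≡⇔))

fromℕ-gap-outside : ∀ {r x y} → x ℕ.≤ y → r ℕ.≤ x ⊎ y ℕ.≤ r → 0ℚ ≤ (fromℕ r - fromℕ x) * (fromℕ r - fromℕ y)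
fromℕ-gap-outside {r} {x} {y} x≤y (inj₁ r≤x) =
  nonNegative⁻¹ _ {{nonPos*nonPos⇒nonPos (fromℕ r - fromℕ x) {{ℚ.nonPositive (≤⇒-≤0 (fromℕ-mono-≤ r≤x))}}
                                         (fromℕ r - fromℕ y) {{ℚ.nonPositive (≤⇒-≤0 (fromℕ-mono-≤ (ℕₚ.≤-trans r≤x x≤y)))}}}}
fromℕ-gap-outside x≤y (inj₂ y≤r) = 0≤-* (≤⇒0≤- (fromℕ-mono-≤ (ℕₚ.≤-trans x≤y y≤r))) (≤⇒0≤- (fromℕ-mono-≤ y≤r))

fromℕ-gap-inside : ∀ {r x y} → x ℕ.≤ r → r ℕ.≤ y → 0ℚ ≤ (fromℕ r - fromℕ x) * (fromℕ y - fromℕ r)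
fromℕ-gap-inside x≤r r≤y = 0≤-* (≤⇒0≤- (fromℕ-mono-≤ x≤r)) (≤⇒0≤- (fromℕ-mono-≤ r≤y))

fromℕ-gap-inside≡0⇔ : ∀ r x y → (fromℕ r - fromℕ x) * (fromℕ y - fromℕ r) ≡ 0ℚ ⇔ (r ≡ x ⊎ r ≡ y)
fromℕ-gap-inside≡0⇔ r x y =
  ⇔-trans *≡0⇔ ((⇔-trans -≡0⇔≡ fromℕ-≡⇔) ⊎-⇔ (⇔-trans -≡0⇔≡ (⇔-trans fromℕ-≡⇔ (mk⇔ sym sym))))

toℕ≡⇔ : ∀ {n} {r s : Fin n} {x} → toℕ s ≡ x → (toℕ r ≡ x ⇔ r ≡ s)
toℕ≡⇔ toℕs≡x = mk⇔ (λ toℕr≡x → Finₚ.toℕ-injective (trans toℕr≡x (sym toℕs≡x))) (λ { refl → toℕs≡x })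

module Polygon (n : ℕ) where
  open Cycle n

  point : Fin (suc n) → Point 2
  point t = fromℕ (toℕ t) ∷ fromℕ (toℕ t) * fromℕ (toℕ t) ∷ []

  vertex-exposed : ∀ t → Exposes point (_≡ t)
  vertex-exposed t = exposes-by-gap {p = point} ((1ℚ + 1ℚ) * t̂ ∷ - 1ℚ ∷ []) (t̂ * t̂) gap
    (λ r → lemma t̂ (fromℕ (toℕ r)))
    (λ r → fromℕ-gap-outside ℕₚ.≤-refl (ℕₚ.≤-total (toℕ r) (toℕ t)))
    (λ r → ⇔-trans (fromℕ-gap≡0⇔ (toℕ r) (toℕ t) (toℕ t)) (⇔-trans (mk⇔ [ id , id ]′ inj₁) (toℕ≡⇔ refl)))
    where
    t̂ = fromℕ (toℕ t)
    gap : Fin (suc n) → ℚ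
    gap r = (fromℕ (toℕ r) - t̂) * (fromℕ (toℕ r) - t̂)
    lemma : ∀ t r → (1ℚ + 1ℚ) * t * r + (- 1ℚ * (r * r) + 0ℚ) + (r - t) * (r - t) ≡ t * t
    lemma = solve-∀ ring

  edge-exposed : ∀ s → Exposes point (λ r → r ≡ prev s ⊎ r ≡ s)
  edge-exposed zero = exposes-by-gap {p = point} (- n̂ ∷ 1ℚ ∷ []) 0ℚ gap
    (λ r → lemma n̂ (fromℕ (toℕ r)))
    (λ r → fromℕ-gap-inside z≤n (Finₚ.toℕ≤pred[n] r))
    (λ r → ⇔-trans (fromℕ-gap-inside≡0⇔ (toℕ r) 0 n) (⇔-trans (mk⇔ swap swap) (toℕ≡⇔ (Finₚ.toℕ-fromℕ n) ⊎-⇔ toℕ≡⇔ refl)))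
    where
    n̂ = fromℕ n
    gap : Fin (suc n) → ℚ
    gap r = (fromℕ (toℕ r) - 0ℚ) * (n̂ - fromℕ (toℕ r))
    lemma : ∀ n r → - n * r + (1ℚ * (r * r) + 0ℚ) + (r - 0ℚ) * (n - r) ≡ 0ℚ
    lemma = solve-∀ ring
  edge-exposed (suc i) = exposes-by-gap {p = point} (1ℚ + x̂ + x̂ ∷ - 1ℚ ∷ []) (x̂ * (1ℚ + x̂)) gap
    (λ r → lemma x̂ (fromℕ (toℕ r)))
    (λ r → fromℕ-gap-outside (ℕₚ.n≤1+n (toℕ i)) (side (toℕ r)))
    (λ r → ⇔-trans (fromℕ-gap≡0⇔ (toℕ r) (toℕ i) (suc (toℕ i))) (toℕ≡⇔ (Finₚ.toℕ-inject₁ i) ⊎-⇔ toℕ≡⇔ refl))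
    where
    x̂ = fromℕ (toℕ i)
    gap : Fin (suc n) → ℚ
    gap r = (fromℕ (toℕ r) - x̂) * (fromℕ (toℕ r) - fromℕ (suc (toℕ i)))
    lemma : ∀ x r → (1ℚ + x + x) * r + (- 1ℚ * (r * r) + 0ℚ) + (r - x) * (r - (1ℚ + x)) ≡ x * (1ℚ + x)
    lemma = solve-∀ ring
    side : ∀ r → r ℕ.≤ toℕ i ⊎ suc (toℕ i) ℕ.≤ r
    side r with r ℕ.≤? toℕ i
    ... | yes r≤i = inj₁ r≤i
    ... | no r≰i  = inj₂ (ℕₚ.≰⇒> r≰i)

  spanning : 2 ℕ.≤ n → Spanning point
  spanning (s≤s (s≤s z≤n)) c constant = coordinates
    where
    f : ℚ → ℚ
    f z = c zero * z + (c (suc zero) * (z * z) + 0ℚ)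
    X₀ X₁ X₂ : ℚ
    X₀ = f 0ℚ
    X₁ = f (1ℚ + 0ℚ)
    X₂ = f (1ℚ + (1ℚ + 0ℚ))
    X₁≡X₀ : X₁ ≡ X₀
    X₁≡X₀ = constant (suc zero) zero
    X₂≡X₀ : X₂ ≡ X₀
    X₂≡X₀ = constant (suc (suc zero)) zero
    interpolate₀ : ∀ a b → let g = λ z → a * z + (b * (z * z) + 0ℚ) in
                   a ≡ (1ℚ + 1ℚ) * (g (1ℚ + 0ℚ) - g 0ℚ) - ½ * (g (1ℚ + (1ℚ + 0ℚ)) - g 0ℚ)
    interpolate₀ = solve-∀ ring
    interpolate₁ : ∀ a b → let g = λ z → a * z + (b * (z * z) + 0ℚ) in
                   b ≡ ½ * (g (1ℚ + (1ℚ + 0ℚ)) - g 0ℚ) - (g (1ℚ + 0ℚ) - g 0ℚ)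
    interpolate₁ = solve-∀ ring
    vanish₀ : ∀ x → (1ℚ + 1ℚ) * (x - x) - ½ * (x - x) ≡ 0ℚ
    vanish₀ = solve-∀ ring
    vanish₁ : ∀ x → ½ * (x - x) - (x - x) ≡ 0ℚ
    vanish₁ = solve-∀ ring
    coordinates : ∀ k → c k ≡ 0ℚ
    coordinates zero = begin
      c zero                                          ≡⟨ interpolate₀ (c zero) (c (suc zero)) ⟩
      (1ℚ + 1ℚ) * (X₁ - X₀) - ½ * (X₂ - X₀)           ≡⟨ cong₂ (λ x y → (1ℚ + 1ℚ) * (x - X₀) - ½ * (y - X₀)) X₁≡X₀ X₂≡X₀ ⟩
      (1ℚ + 1ℚ) * (X₀ - X₀) - ½ * (X₀ - X₀)           ≡⟨ vanish₀ X₀ ⟩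
      0ℚ                                              ∎
      where open ≡-Reasoning
    coordinates (suc zero) = begin
      c (suc zero)                                    ≡⟨ interpolate₁ (c zero) (c (suc zero)) ⟩
      ½ * (X₂ - X₀) - (X₁ - X₀)                       ≡⟨ cong₂ (λ x y → ½ * (y - X₀) - (x - X₀)) X₁≡X₀ X₂≡X₀ ⟩
      ½ * (X₀ - X₀) - (X₀ - X₀)                       ≡⟨ vanish₁ X₀ ⟩
      0ℚ                                              ∎
      where open ≡-Reasoning

  ·-point : ∀ (c : Point 2) {r z} → fromℕ (toℕ r) ≡ z → c · point r ≡ c zero * z + (c (suc zero) * (z * z) + 0ℚ)
  ·-point c refl = refl

  -- If x < y are not consecutive on the cycle, a vertex strictly between them and one outside
  -- [x, y] (x − 1, or y + 1 when x = 0) are in an affine relation with x and y with positive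
  -- weights, since all vertices lie on a parabola; so {x, y} is not a face.
  nonconsecutive-exposed-⊥ : ∀ {i j} → Exposes point (λ r → r ≡ suc i ⊎ r ≡ suc j) → suc (toℕ i) ℕ.< toℕ j → ⊥
  nonconsecutive-exposed-⊥ {i} {j} exposed 1+i<j =
    exposed-face-⊥ {p = point} {k = Fin.inject₁ i} {l = l} {i = suc i} {j = suc j} wₖ wₗ wᵢ wⱼ exposed
      (0≤-* (0≤fromℕ (suc (suc d))) (0≤fromℕ (suc d))) (0<-* (0<fromℕ-suc (suc d)) (0<fromℕ-suc (suc (suc d))))
      (weights d̂) relation (inj₁ refl) (inj₂ refl) l∉ij
    where
    a = fromℕ (toℕ i)
    d = toℕ j ℕ.∸ suc (suc (toℕ i))
    d̂ = fromℕ d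
    j≡2+i+d : toℕ j ≡ suc (suc (toℕ i)) ℕ.+ d
    j≡2+i+d = sym (ℕₚ.m+[n∸m]≡n 1+i<j)
    l : Fin (suc n)
    2+i<1+n : suc (suc (toℕ i)) ℕ.< suc n
    2+i<1+n = ℕₚ.<-trans (ℕₚ.≤-<-trans 1+i<j (Finₚ.toℕ<n j)) (ℕₚ.n<1+n n)
    l = Fin.fromℕ< 2+i<1+n
    toℕ-l : toℕ l ≡ suc (suc (toℕ i))
    toℕ-l = Finₚ.toℕ-fromℕ< 2+i<1+n
    l∉ij : ¬ (l ≡ suc i ⊎ l ≡ suc j)
    l∉ij (inj₁ l≡1+i) = ℕₚ.<-irrefl (trans (sym (cong toℕ l≡1+i)) toℕ-l) (ℕₚ.n<1+n (suc (toℕ i)))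
    l∉ij (inj₂ l≡1+j) = ℕₚ.<-irrefl (trans (sym toℕ-l) (cong toℕ l≡1+j)) (s≤s 1+i<j)
    D = 1ℚ + (1ℚ + d̂)
    wₖ = D * (1ℚ + d̂)
    wₗ = D * (1ℚ + D)
    wᵢ = (1ℚ + 1ℚ) * ((1ℚ + d̂) * (1ℚ + D))
    wⱼ = 1ℚ + 1ℚ
    weights : ∀ d → (1ℚ + (1ℚ + d)) * (1ℚ + d) + (1ℚ + (1ℚ + d)) * (1ℚ + (1ℚ + (1ℚ + d)))
                    ≡ (1ℚ + 1ℚ) * ((1ℚ + d) * (1ℚ + (1ℚ + (1ℚ + d)))) + (1ℚ + 1ℚ)
    weights = solve-∀ ring
    identity : ∀ c₀ c₁ a d → let f = λ z → c₀ * z + (c₁ * (z * z) + 0ℚ); D = 1ℚ + (1ℚ + d) in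
      D * (1ℚ + d) * f a + D * (1ℚ + D) * f (1ℚ + (1ℚ + a))
        ≡ (1ℚ + 1ℚ) * ((1ℚ + d) * (1ℚ + D)) * f (1ℚ + a) + (1ℚ + 1ℚ) * f (1ℚ + ((1ℚ + (1ℚ + a)) + d))
    identity = solve-∀ ring
    relation : ∀ c → wₖ * (c · point (Fin.inject₁ i)) + wₗ * (c · point l) ≡ wᵢ * (c · point (suc i)) + wⱼ * (c · point (suc j))
    relation c = begin
      wₖ * (c · point (Fin.inject₁ i)) + wₗ * (c · point l)
        ≡⟨ cong₂ (λ x y → wₖ * x + wₗ * y) (·-point c {Fin.inject₁ i} (cong fromℕ (Finₚ.toℕ-inject₁ i))) (·-point c {l} (cong fromℕ toℕ-l)) ⟩
      _ ≡⟨ identity (c zero) (c (suc zero)) a d̂ ⟩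
      _ ≡⟨ cong (λ y → wᵢ * (c · point (suc i)) + wⱼ * y)
                (sym (·-point c {suc j} (cong (1ℚ +_) (trans (cong fromℕ j≡2+i+d) (fromℕ-+ (suc (suc (toℕ i))) d))))) ⟩
      wᵢ * (c · point (suc i)) + wⱼ * (c · point (suc j)) ∎
      where open ≡-Reasoning

  nonconsecutive-exposed-from-0-⊥ : ∀ {j} → Exposes point (λ r → r ≡ zero ⊎ r ≡ suc j) → 0 ℕ.< toℕ j → suc (toℕ j) ℕ.< n → ⊥
  nonconsecutive-exposed-from-0-⊥ {j} exposed 0<j 1+j<n =
    exposed-face-⊥ {p = point} {k = k} {l = l} {i = zero} {j = suc j} wₖ wₗ wₖ wₗ exposed
      (0≤-* (0≤fromℕ (suc (suc d))) (0≤fromℕ (suc d))) (0<-* (0<fromℕ-suc (suc d)) (0<fromℕ-suc (suc (suc d))))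
      refl relation (inj₁ refl) (inj₂ refl) l∉ij
    where
    d = toℕ j ℕ.∸ 1
    d̂ = fromℕ d
    ĵ≡1+d̂ : fromℕ (toℕ j) ≡ 1ℚ + d̂
    ĵ≡1+d̂ = cong fromℕ (sym (ℕₚ.m+[n∸m]≡n 0<j))
    Y = 1ℚ + (1ℚ + d̂)
    wₖ = Y * (1ℚ + d̂)
    wₗ = Y * (1ℚ + Y)
    3+j<1+n : suc (suc (toℕ j)) ℕ.< suc n
    3+j<1+n = s≤s 1+j<n
    1<1+n : 1 ℕ.< suc n
    1<1+n = s≤s (ℕₚ.≤-trans (s≤s z≤n) (ℕₚ.<⇒≤ 1+j<n))
    k l : Fin (suc n)
    k = Fin.fromℕ< 3+j<1+n
    l = Fin.fromℕ< 1<1+n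
    toℕ-l : toℕ l ≡ 1
    toℕ-l = Finₚ.toℕ-fromℕ< 1<1+n
    l∉ij : ¬ (l ≡ zero ⊎ l ≡ suc j)
    l∉ij (inj₁ l≡0)   = ℕₚ.1+n≢0 (trans (sym toℕ-l) (cong toℕ l≡0))
    l∉ij (inj₂ l≡1+j) = ℕₚ.<-irrefl (ℕₚ.suc-injective (trans (sym toℕ-l) (cong toℕ l≡1+j))) 0<j
    identity : ∀ c₀ c₁ d → let f = λ z → c₀ * z + (c₁ * (z * z) + 0ℚ); Y = 1ℚ + (1ℚ + d) in
      Y * (1ℚ + d) * f (1ℚ + Y) + Y * (1ℚ + Y) * f (1ℚ + 0ℚ) ≡ Y * (1ℚ + d) * f 0ℚ + Y * (1ℚ + Y) * f Y
    identity = solve-∀ ring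
    relation : ∀ c → wₖ * (c · point k) + wₗ * (c · point l) ≡ wₖ * (c · point zero) + wₗ * (c · point (suc j))
    relation c = begin
      wₖ * (c · point k) + wₗ * (c · point l)
        ≡⟨ cong₂ (λ x y → wₖ * x + wₗ * y)
                 (·-point c {k} (trans (cong fromℕ (Finₚ.toℕ-fromℕ< 3+j<1+n)) (cong (λ z → 1ℚ + (1ℚ + z)) ĵ≡1+d̂)))
                 (·-point c {l} (cong fromℕ toℕ-l)) ⟩
      _ ≡⟨ identity (c zero) (c (suc zero)) d̂ ⟩
      _ ≡⟨ cong (λ y → wₖ * (c · point zero) + wₗ * y) (sym (·-point c {suc j} (cong (1ℚ +_) ĵ≡1+d̂))) ⟩
      wₖ * (c · point zero) + wₗ * (c · point (suc j)) ∎
      where open ≡-Reasoning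

  exposed-pair⇒consecutive-< : ∀ {t s} → Exposes point (λ r → r ≡ t ⊎ r ≡ s) → toℕ t ℕ.< toℕ s → t ≡ prev s ⊎ s ≡ prev t
  exposed-pair⇒consecutive-< {t} {suc j} exposed t<s with toℕ t ℕ.≟ toℕ j
  ... | yes t≡j = inj₁ (Finₚ.toℕ-injective (trans t≡j (sym (Finₚ.toℕ-inject₁ j))))
  ... | no t≢j  = far t (ℕₚ.≤∧≢⇒< (ℕₚ.≤-pred t<s) t≢j) exposed
    where
    far : ∀ t → toℕ t ℕ.< toℕ j → Exposes point (λ r → r ≡ t ⊎ r ≡ suc j) → t ≡ prev (suc j) ⊎ suc j ≡ prev t
    far zero    0<j   exposed with suc j ≟ Fin.fromℕ n
    ... | yes s≡last = inj₂ s≡last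
    ... | no s≢last  = ⊥-elim (nonconsecutive-exposed-from-0-⊥ exposed 0<j
                         (ℕₚ.≤∧≢⇒< (Finₚ.toℕ≤pred[n] (suc j)) (s≢last ∘ Equivalence.to (toℕ≡⇔ (Finₚ.toℕ-fromℕ n)))))
    far (suc i) 1+i<j exposed = ⊥-elim (nonconsecutive-exposed-⊥ exposed 1+i<j)

  exposed-pair⇒consecutive : ∀ {t s} → Exposes point (λ r → r ≡ t ⊎ r ≡ s) → t ≢ s → t ≡ prev s ⊎ s ≡ prev t
  exposed-pair⇒consecutive {t} {s} exposed t≢s with ℕₚ.<-cmp (toℕ t) (toℕ s)
  ... | tri< t<s _ _ = exposed-pair⇒consecutive-< exposed t<s
  ... | tri≈ _ t≡s _ = ⊥-elim (t≢s (Finₚ.toℕ-injective t≡s))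
  ... | tri> _ _ s<t = swap (exposed-pair⇒consecutive-< (exposes-⇔ {p = point} (λ _ → mk⇔ swap swap) exposed) s<t)

-- Prisms over a polygon

module Prism (n : ℕ) (2≤n : 2 ℕ.≤ n) (e : ℕ) where
  open Cycle n
  open Pairs (suc n) (suc e)
  module P = Polygon n
  module S = Simplex e

  Vertex : Set
  Vertex = Fin (suc n) × Fin (suc e)

  point : Vertex → Point (2 ℕ.+ e)
  point = P.point ⊕ S.corner

  pair : Fin (suc n ℕ.* suc e) → Vertex
  pair u = base u , fibre u

  unpair : Vertex → Fin (suc n ℕ.* suc e)
  unpair (t , a) = combine t a

  pair-unpair : ∀ x → pair (unpair x) ≡ x
  pair-unpair (t , a) = Finₚ.remQuot-combine t a

  pair≡⇔ : ∀ {u w} → pair u ≡ pair w ⇔ u ≡ w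
  pair≡⇔ = mk⇔ (λ e → ≡-pairs (cong proj₁ e) (cong proj₂ e)) (cong pair)

  unpair≡⇔ : ∀ {x u} → unpair x ≡ u ⇔ x ≡ pair u
  unpair≡⇔ {x} = mk⇔ (λ { refl → sym (pair-unpair x) }) (λ { refl → Finₚ.combine-remQuot {suc n} (suc e) _ })

  position : Fin (suc n ℕ.* suc e) → Point (2 ℕ.+ e)
  position = point ∘ pair

  exposes-position : ∀ {Z} → Exposes point Z → Exposes position (Z ∘ pair)
  exposes-position = exposes-reindex {p = point} pair (λ _ → refl)

  exposes-point : ∀ {Z} → Exposes position Z → Exposes point (Z ∘ unpair)
  exposes-point = exposes-reindex {p = position} unpair (λ x → cong point (pair-unpair x))

  vertex-exposed : ∀ u → Exposes position (_≡ u)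
  vertex-exposed u = exposes-⇔ {p = position} (λ w → mk⇔ (uncurry ≡-pairs) (λ { refl → refl , refl }))
                       (exposes-position (exposes-⊕ {p = P.point} {q = S.corner} (P.vertex-exposed (base u)) (S.subset-exposed (_≟ fibre u))))

  separated : ∀ u → ∃ λ (c : Point (2 ℕ.+ e)) → ∀ w → w ≢ u → c · position w < c · position u
  separated u = exposed-point⇒vertex {p = position} (vertex-exposed u)

  polytope : Polytope (2 ℕ.+ e)
  polytope = record
    { n        = suc n ℕ.* suc e
    ; pts      = position
    ; distinct = strictly-separated⇒injective separated
    ; vertex   = separated
    ; fullDim  = spanning-reindex {p = position} unpair (λ x → cong point (pair-unpair x))
                   (spanning-⊕ {p = P.point} {q = S.corner} (P.spanning 2≤n) S.spanning zero zero)
    }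

  Adjacent : Vertex → Vertex → Set
  Adjacent (t , a) (s , b) = ((t ≡ prev s ⊎ s ≡ prev t) × a ≡ b) ⊎ (t ≡ s × a ≢ b)

  adjacent⇒≢ : ∀ {x y} → Adjacent x y → x ≢ y
  adjacent⇒≢ (inj₁ (inj₁ t≡prev-t , _)) refl = prev≢id (ℕₚ.≤-trans (s≤s z≤n) 2≤n) _ (sym t≡prev-t)
  adjacent⇒≢ (inj₁ (inj₂ t≡prev-t , _)) refl = prev≢id (ℕₚ.≤-trans (s≤s z≤n) 2≤n) _ (sym t≡prev-t)
  adjacent⇒≢ (inj₂ (_ , a≢a))            refl = a≢a refl

  ,≡,⇔ : ∀ {r t : Fin (suc n)} {c a : Fin (suc e)} → (r ≡ t × c ≡ a) ⇔ ((r , c) ≡ (t , a))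
  ,≡,⇔ = ↔⇒⇔ ×-≡,≡↔≡

  adjacent⇒exposed : ∀ {x y} → Adjacent x y → Exposes point (λ z → z ≡ x ⊎ z ≡ y)
  adjacent⇒exposed {t , a} {s , b} (inj₁ (inj₁ refl , refl)) =
    exposes-⇔ {p = point} (λ _ → ⇔-trans (↔⇒⇔ (×-distribʳ-⊎ 0ℓ _ _ _)) (,≡,⇔ ⊎-⇔ ,≡,⇔))
      (exposes-⊕ {p = P.point} {q = S.corner} (P.edge-exposed s) (S.subset-exposed (_≟ a)))
  adjacent⇒exposed {t , a} {s , b} (inj₁ (inj₂ refl , refl)) =
    exposes-⇔ {p = point} (λ _ → ⇔-trans (↔⇒⇔ (×-distribʳ-⊎ 0ℓ _ _ _)) (⇔-trans (,≡,⇔ ⊎-⇔ ,≡,⇔) (mk⇔ swap swap)))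
      (exposes-⊕ {p = P.point} {q = S.corner} (P.edge-exposed t) (S.subset-exposed (_≟ a)))
  adjacent⇒exposed {t , a} {s , b} (inj₂ (refl , a≢b)) =
    exposes-⇔ {p = point} (λ _ → ⇔-trans (↔⇒⇔ (×-distribˡ-⊎ 0ℓ _ _ _)) (,≡,⇔ ⊎-⇔ ,≡,⇔))
      (exposes-⊕ {p = P.point} {q = S.corner} (P.vertex-exposed t) (S.subset-exposed (λ c → (c ≟ a) ⊎-dec (c ≟ b))))

  exposed⇒adjacent : ∀ {x y} → x ≢ y → Exposes point (λ z → z ≡ x ⊎ z ≡ y) → Adjacent x y
  exposed⇒adjacent {t , a} {s , b} x≢y exposed with t ≟ s | a ≟ b
  ... | yes refl | yes refl = ⊥-elim (x≢y refl)
  ... | yes t≡s  | no a≢b   = inj₂ (t≡s , a≢b)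
  ... | no t≢s   | yes refl = inj₁ (P.exposed-pair⇒consecutive polygon-edge t≢s , refl)
    where
    polygon-edge : Exposes P.point (λ r → r ≡ t ⊎ r ≡ s)
    polygon-edge = exposes-⇔ {p = P.point} (λ _ → ⇔-sym (at-a-≡⇔ ⊎-⇔ at-a-≡⇔))
                     (exposes-slice {p = P.point} {q = S.corner} exposed a)
      where
      at-a-≡⇔ : ∀ {r t} → r ≡ t ⇔ (r , a) ≡ (t , a)
      at-a-≡⇔ = ⇔-trans (mk⇔ (_, refl) proj₁) ,≡,⇔
  ... | no t≢s   | no a≢b   = ⊥-elim
    (exposed-face-⊥ {p = point} {k = t , b} {l = s , a} {i = t , a} {j = s , b} 1ℚ 1ℚ 1ℚ 1ℚ exposed
                    (<⇒≤ (positive⁻¹ 1ℚ)) (positive⁻¹ 1ℚ) refl parallelogram (inj₁ refl) (inj₂ refl)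
                    [ t≢s ∘ sym ∘ cong proj₁ , a≢b ∘ cong proj₂ ]′)
    where
    parallelogram : ∀ c → 1ℚ * (c · point (t , b)) + 1ℚ * (c · point (s , a))
                          ≡ 1ℚ * (c · point (t , a)) + 1ℚ * (c · point (s , b))
    parallelogram c = begin
      1ℚ * (c · point (t , b)) + 1ℚ * (c · point (s , a))
        ≡⟨ cong₂ (λ x y → 1ℚ * x + 1ℚ * y) (·-++ c (P.point t) (S.corner b)) (·-++ c (P.point s) (S.corner a)) ⟩
      1ℚ * (L t + R b) + 1ℚ * (L s + R a)
        ≡⟨ swap-fibres (L t) (L s) (R a) (R b) ⟩
      1ℚ * (L t + R a) + 1ℚ * (L s + R b)
        ≡⟨ sym (cong₂ (λ x y → 1ℚ * x + 1ℚ * y) (·-++ c (P.point t) (S.corner a)) (·-++ c (P.point s) (S.corner b))) ⟩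
      1ℚ * (c · point (t , a)) + 1ℚ * (c · point (s , b)) ∎
      where
      open ≡-Reasoning
      L : Fin (suc n) → ℚ
      L r = (c ∘ (_↑ˡ e)) · P.point r
      R : Fin (suc e) → ℚ
      R a = (c ∘ (2 ↑ʳ_)) · S.corner a
      swap-fibres : ∀ lt ls ra rb → 1ℚ * (lt + rb) + 1ℚ * (ls + ra) ≡ 1ℚ * (lt + ra) + 1ℚ * (ls + rb)
      swap-fibres = solve-∀ ring

  adjacency⇔edge : ∀ u w → (cycle □K[ suc e ]) u w ≡ true ⇔ IsEdge polytope u w
  adjacency⇔edge u w =
    ⇔-trans (□K≡true⇔ u w) (⇔-trans ((cycle≡true⇔ (base u) (base w) ×-⇔ ⇔-refl) ⊎-⇔ ⇔-refl) (mk⇔ to from))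
    where
    open □K-Graph cycle (suc e) using (□K≡true⇔)
    to : Adjacent (pair u) (pair w) → IsEdge polytope u w
    to adjacent = adjacent⇒≢ adjacent ∘ cong pair ,
                  exposes-⇔ {p = position} (λ _ → pair≡⇔ ⊎-⇔ pair≡⇔) (exposes-position (adjacent⇒exposed adjacent))
    from : IsEdge polytope u w → Adjacent (pair u) (pair w)
    from (u≢w , exposed) = exposed⇒adjacent (u≢w ∘ Equivalence.to pair≡⇔)
                             (exposes-⇔ {p = point} (λ _ → unpair≡⇔ ⊎-⇔ unpair≡⇔) (exposes-point exposed))

  resistance-positive : ResistancePositive polytope
  resistance-positive = cycle □K[ suc e ] , adjacency⇔edge , cycle□K-resistance-positive n 2≤n e

combEquiv⇒vertex-count : ∀ {d} {P Q : Polytope d} → CombEquiv P Q → n P ≡ n Q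
combEquiv⇒vertex-count (σ , _) = ↔⇒≡ σ

theorem1p13 : ∀ (d : ℕ) → d ≥ 2 →
    Σ (ℕ → Polytope d) λ F →
      (∀ k → ResistancePositive (F k)) ×
      (∀ k l → k ≢ l → ¬ CombEquiv (F k) (F l))
theorem1p13 (suc (suc e)) (s≤s (s≤s z≤n)) = prism , resistance-positive , inequivalent
  where
  prism : ℕ → Polytope (2 ℕ.+ e)
  prism k = Prism.polytope (2 ℕ.+ k) (s≤s (s≤s z≤n)) e
  resistance-positive : ∀ k → ResistancePositive (prism k)
  resistance-positive k = Prism.resistance-positive (2 ℕ.+ k) (s≤s (s≤s z≤n)) e
  inequivalent : ∀ k l → k ≢ l → ¬ CombEquiv (prism k) (prism l)
  inequivalent k l k≢l equiv =
    k≢l (ℕₚ.+-cancelˡ-≡ 3 k l (ℕₚ.*-cancelʳ-≡ _ _ (suc e) (combEquiv⇒vertex-count {P = prism k} {prism l} equiv)))
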